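{- Let $x_1,x_2,\dots$ be indeterminates. Then, as formal power series, $$\sum_{\pi\in\mathcal{P}(132)}\prod_{d\ge 1}x_d^{12\ldots d(\pi)} = 1 + \sum_{n\ge 1}\frac{\prod_{j\ge 1}x_j^{\binom{n}{j}}}{\prod_{m=1}^{n}\left(1 - \prod_{j\ge 1}x_j^{\binom{m-1}{j-1}} - \prod_{j\ge 1}x_j^{2\binom{m-1}{j-1}}x_{j+1}^{\binom{m-1}{j-1}}\right)}.$$
   Context: $S_n$ is the set of permutations of $\{1,\dots,n\}$ in one-line notation. A permutation avoids a pattern $\sigma\in S_k$ if it has no subsequence of length $k$ whose entries are in the same relative order as $\sigma$. $\mathcal{P}_n(132)$ is the set of permutations in $S_n$ avoiding each of $132$, $2341$, $3241$ (equivalently, the two-stack sortable permutations avoiding $132$), $\mathcal{P}_0(132)$ contains only the empty permutation, and $\mathcal{P}(132)=\bigcup_{n\ge 0}\mathcal{P}_n(132)$. For a permutation $\pi$ and $d\ge 1$, $12\ldots d(\pi)$ denotes the number of increasing subsequences of length $d$ in $\pi$ (occurrences of the pattern $12\ldots d$). Binomial coefficients $\binom{a}{b}$ are $0$ when $b<0$ or $b>a$. -}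

module Defs where

open import Data.Bool using (Bool; true; false; _∧_; _∨_; not; if_then_else_)
open import Data.Nat using (ℕ; zero; suc; _∸_; _≤_; _≡ᵇ_; _<ᵇ_) renaming (_+_ to _+ℕ_; _*_ to _*ℕ_)
open import Data.Nat.Combinatorics using (_C_)
open import Data.Integer using (ℤ; +_; 0ℤ; 1ℤ) renaming (_+_ to _+ℤ_; _*_ to _*ℤ_; _-_ to _-ℤ_)
open import Data.List using (List; []; _∷_; length; map; filter; concat; concatMap; foldr; _++_; zip; applyUpTo; upTo)
open import Data.Product using (_×_; _,_; ∃; proj₁; proj₂)
open import Data.Bool.ListAction using (all; any)
open import Relation.Binary.PropositionalEquality using (_≡_)
open import Relation.Nullary.Decidable using (Dec; yes; no)
open import Data.Bool.Properties using () renaming (_≟_ to _≟B_)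

subseqs : List ℕ → List (List ℕ)
subseqs []       = [] ∷ []
subseqs (x ∷ xs) = let r = subseqs xs in r ++ map (x ∷_) r

elemᵇ : ℕ → List ℕ → Bool
elemᵇ x []       = false
elemᵇ x (y ∷ ys) = (x ≡ᵇ y) ∨ elemᵇ x ys

distinct : List ℕ → Bool
distinct []       = true
distinct (x ∷ xs) = not (elemᵇ x xs) ∧ distinct xs

words : ℕ → List ℕ → List (List ℕ)
words zero    A = [] ∷ []
words (suc k) A = concatMap (λ a → map (a ∷_) (words k A)) A

-- S_n : the permutations of {1,…,n} in one-line notation
-- (words of length n over {1,…,n} with pairwise distinct entries)
S : ℕ → List (List ℕ)
S n = filter (λ w → distinct w ≟B true) (words n (applyUpTo suc n))

eqBool : Bool → Bool → Bool
eqBool true  b = b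
eqBool false b = not b

-- τ and σ are in the same relative order (entries assumed distinct)
sameOrder : List ℕ → List ℕ → Bool
sameOrder []       []       = true
sameOrder (t ∷ ts) (s ∷ ss) =
  all (λ p → eqBool (t <ᵇ proj₁ p) (s <ᵇ proj₂ p)) (zip ts ss)
  ∧ sameOrder ts ss
sameOrder _        _        = false

contains : List ℕ → List ℕ → Bool
contains π σ = any (λ τ → (length τ ≡ᵇ length σ) ∧ sameOrder τ σ) (subseqs π)

avoids : List ℕ → List ℕ → Bool
avoids π σ = not (contains π σ)

inP132 : List ℕ → Bool
inP132 π = avoids π (1 ∷ 3 ∷ 2 ∷ []) ∧ avoids π (2 ∷ 3 ∷ 4 ∷ 1 ∷ []) ∧ avoids π (3 ∷ 2 ∷ 4 ∷ 1 ∷ [])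

P132 : ℕ → List (List ℕ)
P132 n = filter (λ π → inP132 π ≟B true) (S n)

increasing : List ℕ → Bool
increasing []           = true
increasing (x ∷ [])     = true
increasing (x ∷ y ∷ xs) = (x <ᵇ y) ∧ increasing (y ∷ xs)

incCount : ℕ → List ℕ → ℕ
incCount d π = length (filter (λ τ → ((length τ ≡ᵇ d) ∧ increasing τ) ≟B true) (subseqs π))

-- Monomials in x₁, x₂, … : exponent lists (e₁, e₂, …), i.e. x₁^e₁ x₂^e₂ …,
-- identified modulo trailing zeros.

Mono : Set
Mono = List ℕ

norm : Mono → Mono
norm []       = []
norm (x ∷ xs) with norm xs
... | []      = if x ≡ᵇ 0 then [] else x ∷ []
... | r@(_ ∷ _) = x ∷ r

eqListᵇ : List ℕ → List ℕ → Bool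
eqListᵇ []       []       = true
eqListᵇ (x ∷ xs) (y ∷ ys) = (x ≡ᵇ y) ∧ eqListᵇ xs ys
eqListᵇ _        _        = false

sameMono : Mono → Mono → Bool
sameMono e f = eqListᵇ (norm e) (norm f)

-- the monomial ∏_{d≥1} x_d^{12…d(π)}  (the exponents vanish for d > |π|)
monoOf : List ℕ → Mono
monoOf π = map (λ d → incCount d π) (applyUpTo suc (length π))

-- Formal power series in x₁, x₂, … with integer coefficients:
-- a coefficient for each monomial. Operations read coefficients at
-- normalised monomials only.

FPS : Set
FPS = Mono → ℤ

_≈_ : FPS → FPS → Set
f ≈ g = ∀ e → f e ≡ g e

sumℤ : List ℤ → ℤ
sumℤ = foldr _+ℤ_ 0ℤ

boolℤ : Bool → ℤ
boolℤ true  = 1ℤ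
boolℤ false = 0ℤ

mono : Mono → FPS
mono e f = boolℤ (sameMono e f)

one : FPS
one = mono []

_⊕_ : FPS → FPS → FPS
(f ⊕ g) e = f (norm e) +ℤ g (norm e)

_⊖_ : FPS → FPS → FPS
(f ⊖ g) e = f (norm e) -ℤ g (norm e)

splits : Mono → List (Mono × Mono)
splits []       = ([] , []) ∷ []
splits (a ∷ e)  =
  concatMap (λ i → map (λ p → (i ∷ proj₁ p) , ((a ∸ i) ∷ proj₂ p)) (splits e))
            (upTo (suc a))

_⊛_ : FPS → FPS → FPS
(f ⊛ g) e = sumℤ (map (λ p → f (norm (proj₁ p)) *ℤ g (norm (proj₂ p))) (splits (norm e)))

prodFrom1 : (ℕ → FPS) → ℕ → FPS
prodFrom1 F zero    = one
prodFrom1 F (suc n) = prodFrom1 F n ⊛ F (suc n)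

partial : (ℕ → FPS) → ℕ → FPS
partial T zero    e = 0ℤ
partial T (suc M) e = partial T M e +ℤ T M e

SumsTo : (ℕ → FPS) → FPS → Set
SumsTo T S = ∀ e → ∃ λ N → ∀ M → N ≤ M → partial T M e ≡ S e

lhsTerm : ℕ → FPS
lhsTerm n e = + length (filter (λ π → sameMono (monoOf π) e ≟B true) (P132 n))

numExp : ℕ → Mono
numExp n = map (λ j → n C j) (applyUpTo suc n)

-- ∏_{j≥1} x_j^{C(m-1,j-1)}   (exponent of x_{i+1} is C(m-1,i))
aExp : ℕ → Mono
aExp m = map (λ i → (m ∸ 1) C i) (upTo m)

-- ∏_{j≥1} x_j^{2C(m-1,j-1)} x_{j+1}^{C(m-1,j-1)}
-- exponent of x_{i+1} is 2·C(m-1,i) + C(m-1,i-1)  (the latter 0 for i = 0)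
prevC : ℕ → ℕ → ℕ
prevC m zero    = 0
prevC m (suc i) = (m ∸ 1) C i

bExp : ℕ → Mono
bExp m = map (λ i → (2 *ℕ ((m ∸ 1) C i)) +ℕ prevC m i) (upTo (suc m))

denom : ℕ → FPS
denom m = (one ⊖ mono (aExp m)) ⊖ mono (bExp m)

AreInverses : (ℕ → FPS) → Set
AreInverses G = ∀ m → 1 ≤ m → (G m ⊛ denom m) ≈ one

-- the n-th summand on the right (n ≥ 1), with the 1 as the 0-th summand
rhsTerm : (ℕ → FPS) → ℕ → FPS
rhsTerm G zero    = one
rhsTerm G (suc n) = mono (numExp (suc n)) ⊛ prodFrom1 G (suc n)

-- Every π ∈ P(132) is uniquely B ⊖ (π′ ⊕ 1) with π′ ∈ P(132), where the top part B is a
-- decreasing sequence of blocks, each a single entry or an ascending adjacent pair; any other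
-- shape contains a 132, 2341 or 3241.  Reading B as a word over {a, b} and iterating, P(132)
-- is in bijection with finite sequences (w₁, …, w_n) of such words.  Increasing subsequences
-- add up over skew sums, and appending a new maximum multiplies by x₁ after substituting
-- x_j ↦ x_j x_{j+1}; by Pascal's rule the monomial of the permutation is therefore
-- ∏_j x_j^{C(n,j)} times a factor a_m (resp. b_m) for each letter a (resp. b) of w_m, where
-- 1 − a_m − b_m is the m-th denominator.  As 1/(1 − a_m − b_m) enumerates the words at
-- level m, the n-th term on the right enumerates the sequences of n words.  A monomial of x₁-degree K
-- occurs only for permutations of size K and for sequences of at most K words of length at
-- most K, so both sides converge coefficientwise to the same finite count.

module Submission where

open import Defs

import Algebra.Properties.CommutativeSemigroup as CommutativeSemigroupProperties
open import Data.Bool using (Bool; true; false; _∧_; not; if_then_else_)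
open import Data.Bool.Properties using (T-≡; ∧-zeroʳ) renaming (_≟_ to _≟B_)
open import Data.Empty using (⊥; ⊥-elim)
open import Data.Integer using (ℤ; +_; 0ℤ; 1ℤ) renaming (_+_ to _+ℤ_; _*_ to _*ℤ_; _-_ to _-ℤ_)
import Data.Integer.Properties as ℤ
open import Data.Integer.Tactic.RingSolver using (solve-∀)
open import Data.List
  using (List; []; _∷_; map; concatMap; _++_; upTo; applyUpTo; length; filter; cartesianProduct; initLast; _∷ʳ′_)
open import Data.List.Membership.Propositional using (_∈_; _∉_; find; lose)
open import Data.List.Membership.Propositional.Properties
  using ( ∈-∃++; ∈-++⁻; ∈-++⁺ˡ; ∈-++⁺ʳ; ∈-map⁻; ∈-map⁺; ∈-concatMap⁺; ∈-concatMap⁻; ∈-filter⁺; ∈-filter⁻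
        ; ∈-applyUpTo⁺; ∈-applyUpTo⁻; ∈-cartesianProduct⁻; ∈-cartesianProduct⁺ )
open import Data.List.Properties
  using (∷-injective; ∷ʳ-injective; ++-cancelˡ; ++-assoc; ++-identityʳ; length-++; map-∘; map-cong; map-id)
open import Data.List.Relation.Binary.Sublist.Propositional
  using (_⊆_; []; _∷_; _∷ʳ_; ⊆-refl; ⊆-trans; minimum; from∈)
open import Data.List.Relation.Binary.Sublist.Propositional.Properties using (All-resp-⊆; ++⁺ˡ; ++⁺ʳ)
open import Data.List.Relation.Unary.All using (All; []; _∷_)
import Data.List.Relation.Unary.All as All
import Data.List.Relation.Unary.All.Properties as All
open import Data.List.Relation.Unary.AllPairs using ([]; _∷_)
open import Data.List.Relation.Unary.Any using (here; there)
open import Data.List.Relation.Unary.Any.Properties using (any⁺; any⁻)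
open import Data.List.Relation.Unary.Unique.Propositional using (Unique)
import Data.List.Relation.Unary.Unique.Propositional.Properties as Unique
open import Data.Nat using (ℕ; zero; suc; pred; _+_; _*_; _∸_; _≤_; _<_; _≡ᵇ_; _<ᵇ_; _≤ᵇ_; z≤n; s≤s)
open import Data.Nat.Combinatorics using (_C_; k>n⇒nCk≡0; nCk+nC[k+1]≡[n+1]C[k+1])
open import Data.Nat.Induction using (<-rec)
open import Data.Nat.Properties
  using ( _≟_; _<?_; ≡ᵇ⇒≡; ≡⇒≡ᵇ; <ᵇ⇒<; <⇒<ᵇ; ≤ᵇ⇒≤; ≤⇒≤ᵇ; <-cmp; suc-injective
        ; ≤-refl; ≤-reflexive; ≤-trans; ≤-pred; <-irrefl; <-asym; <-trans; <⇒≤; <⇒≢; >⇒≢; <⇒≯; <⇒≱; ≤⇒≯; ≮⇒≥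
        ; n≮n; ≤∧≢⇒<; n<1+n; n≤1+n; m<n⇒m<1+n; m≤n⇒m≤1+n; m≤n⇒m<n∨m≡n; m≤m+n; m≤n+m; pred[n]≤n
        ; +-comm; +-assoc; +-suc; +-identityʳ; +-cancelʳ-≡; +-commutativeSemigroup
        ; m+n∸n≡m; m∸n+n≡m; m∸[m∸n]≡n; m∸n≤m; 0∸n≡0; ∸-monoʳ-≤; ∸-monoˡ-≤ )
open import Data.Nat.Tactic.RingSolver using () renaming (solve-∀ to ℕ-solve)
open import Data.Product using (∃; _×_; _,_; proj₁; proj₂)
import Data.Product as Product
open import Data.Sum using (_⊎_; inj₁; inj₂)
import Data.Sum as Sum
open import Data.Unit using (tt)
open import Function using (_∘_; id; case_of_; _⟨_⟩_)
open import Function.Bundles using (Equivalence)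
open import Relation.Binary.Bundles using (Setoid)
open import Relation.Binary.Definitions using (tri<; tri≈; tri>)
open import Relation.Binary.PropositionalEquality
  using (_≡_; _≢_; refl; sym; trans; cong; cong₂; subst; module ≡-Reasoning)
import Relation.Binary.Reasoning.Setoid as SetoidReasoning
open import Relation.Nullary using (¬_; Dec; yes; no)

open import Data.List.Membership.DecPropositional _≟_ using (_∈?_)

open CommutativeSemigroupProperties +-commutativeSemigroup using (interchange; xy∙z≈xz∙y)
module ℤ+ = CommutativeSemigroupProperties ℤ.+-commutativeSemigroup

≡ᵇ-true⇒≡ : ∀ {m n} → (m ≡ᵇ n) ≡ true → m ≡ n
≡ᵇ-true⇒≡ {m} {n} p = ≡ᵇ⇒≡ m n (Equivalence.from T-≡ p)

≡⇒≡ᵇ-true : ∀ {m n} → m ≡ n → (m ≡ᵇ n) ≡ true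
≡⇒≡ᵇ-true {m} {n} p = Equivalence.to T-≡ (≡⇒≡ᵇ m n p)

≢⇒≡ᵇ-false : ∀ {m n} → m ≢ n → (m ≡ᵇ n) ≡ false
≢⇒≡ᵇ-false {m} {n} m≢n with m ≡ᵇ n in eq
... | true  = ⊥-elim (m≢n (≡ᵇ-true⇒≡ eq))
... | false = refl

≤ᵇ-true⇒≤ : ∀ {m n} → (m ≤ᵇ n) ≡ true → m ≤ n
≤ᵇ-true⇒≤ {m} {n} p = ≤ᵇ⇒≤ m n (Equivalence.from T-≡ p)

≤⇒≤ᵇ-true : ∀ {m n} → m ≤ n → (m ≤ᵇ n) ≡ true
≤⇒≤ᵇ-true p = Equivalence.to T-≡ (≤⇒≤ᵇ p)

<ᵇ-true⇒< : ∀ {m n} → (m <ᵇ n) ≡ true → m < n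
<ᵇ-true⇒< {m} {n} p = <ᵇ⇒< m n (Equivalence.from T-≡ p)

<⇒<ᵇ-true : ∀ {m n} → m < n → (m <ᵇ n) ≡ true
<⇒<ᵇ-true p = Equivalence.to T-≡ (<⇒<ᵇ p)

≮⇒<ᵇ-false : ∀ {m n} → ¬ m < n → (m <ᵇ n) ≡ false
≮⇒<ᵇ-false {m} {n} m≮n with m <ᵇ n in eq
... | true  = ⊥-elim (m≮n (<ᵇ-true⇒< eq))
... | false = refl

∧-true⁻ : ∀ {a b} → (a ∧ b) ≡ true → a ≡ true × b ≡ true
∧-true⁻ {true} {true} _ = refl , refl

∧-true⁺ : ∀ {a b} → a ≡ true → b ≡ true → (a ∧ b) ≡ true
∧-true⁺ refl refl = refl

bool-≡ : ∀ {a b} → (a ≡ true → b ≡ true) → (b ≡ true → a ≡ true) → a ≡ b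
bool-≡ {true}  {true}  _ _ = refl
bool-≡ {true}  {false} f _ = sym (f refl)
bool-≡ {false} {true}  _ g = g refl
bool-≡ {false} {false} _ _ = refl

exponent : ℕ → Mono → ℕ
exponent i       []       = 0
exponent zero    (x ∷ _)  = x
exponent (suc i) (_ ∷ xs) = exponent i xs

tailᵉ : Mono → Mono
tailᵉ []       = []
tailᵉ (_ ∷ xs) = xs

exponent-suc : ∀ i v → exponent (suc i) v ≡ exponent i (tailᵉ v)
exponent-suc i []      = refl
exponent-suc i (_ ∷ _) = refl

infix 4 _≋_

record _≋_ (u v : Mono) : Set where
  constructor pointwise
  field at : ∀ i → exponent i u ≡ exponent i v
open _≋_ public

≋-refl : ∀ {u} → u ≋ u
≋-refl = pointwise λ _ → refl

≋-sym : ∀ {u v} → u ≋ v → v ≋ u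
≋-sym p = pointwise λ i → sym (at p i)

≋-trans : ∀ {u v w} → u ≋ v → v ≋ w → u ≋ w
≋-trans p q = pointwise λ i → trans (at p i) (at q i)

≋-setoid : Setoid _ _
≋-setoid = record
  { Carrier       = Mono
  ; _≈_           = _≋_
  ; isEquivalence = record { refl = ≋-refl ; sym = ≋-sym ; trans = ≋-trans } }

exponent-norm : ∀ e i → exponent i (norm e) ≡ exponent i e
exponent-norm []       i = refl
exponent-norm (x ∷ xs) i with norm xs | exponent-norm xs
exponent-norm (x ∷ xs) i       | [] | ih with x ≡ᵇ 0 in eq
exponent-norm (x ∷ xs) zero    | [] | ih | true  = sym (≡ᵇ-true⇒≡ eq)
exponent-norm (x ∷ xs) (suc i) | [] | ih | true  = ih i
exponent-norm (x ∷ xs) zero    | [] | ih | false = refl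
exponent-norm (x ∷ xs) (suc i) | [] | ih | false = ih i
exponent-norm (x ∷ xs) zero    | _ ∷ _ | ih = refl
exponent-norm (x ∷ xs) (suc i) | _ ∷ _ | ih = ih i

norm-≋ : ∀ e → norm e ≋ e
norm-≋ e = pointwise (exponent-norm e)

-- the lists without trailing zeros, i.e. the image of norm
data Normal : Mono → Set where
  []  : Normal []
  [_] : ∀ {x} → x ≢ 0 → Normal (x ∷ [])
  _∷_ : ∀ x {y ys} → Normal (y ∷ ys) → Normal (x ∷ y ∷ ys)

Normal-norm : ∀ e → Normal (norm e)
Normal-norm []       = []
Normal-norm (x ∷ xs) with norm xs | Normal-norm xs
... | []    | _ with x ≡ᵇ 0 in eq
...   | true  = []
...   | false = [ (λ x≡0 → case trans (sym (≡⇒≡ᵇ-true x≡0)) eq of λ ()) ]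
Normal-norm (x ∷ xs) | _ ∷ _ | n = x ∷ n

Normal-≋[]⇒≡[] : ∀ {a} → Normal a → a ≋ [] → a ≡ []
Normal-≋[]⇒≡[] []        _ = refl
Normal-≋[]⇒≡[] [ x≢0 ]   p = ⊥-elim (x≢0 (at p 0))
Normal-≋[]⇒≡[] (x ∷ n)   p with Normal-≋[]⇒≡[] n (pointwise λ i → at p (suc i))
... | ()

Normal-≋⇒≡ : ∀ {a b} → Normal a → Normal b → a ≋ b → a ≡ b
Normal-≋⇒≡ []    nb p = sym (Normal-≋[]⇒≡[] nb (≋-sym p))
Normal-≋⇒≡ na    [] p = Normal-≋[]⇒≡[] na p
Normal-≋⇒≡ [ _ ] [ _ ] p = cong (_∷ []) (at p 0)
Normal-≋⇒≡ [ _ ] (_ ∷ nb) p with Normal-≋[]⇒≡[] nb (pointwise λ i → sym (at p (suc i)))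
... | ()
Normal-≋⇒≡ (_ ∷ na) [ _ ] p with Normal-≋[]⇒≡[] na (pointwise λ i → at p (suc i))
... | ()
Normal-≋⇒≡ (x ∷ na) (y ∷ nb) p =
  cong₂ _∷_ (at p 0) (Normal-≋⇒≡ na nb (pointwise λ i → at p (suc i)))

norm-cong : ∀ {u v} → u ≋ v → norm u ≡ norm v
norm-cong {u} {v} p =
  Normal-≋⇒≡ (Normal-norm u) (Normal-norm v) (≋-trans (norm-≋ u) (≋-trans p (≋-sym (norm-≋ v))))

eqListᵇ-true⇒≡ : ∀ a b → eqListᵇ a b ≡ true → a ≡ b
eqListᵇ-true⇒≡ []       []       _ = refl
eqListᵇ-true⇒≡ (x ∷ a) (y ∷ b) p =
  cong₂ _∷_ (≡ᵇ-true⇒≡ (proj₁ (∧-true⁻ p))) (eqListᵇ-true⇒≡ a b (proj₂ (∧-true⁻ p)))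

eqListᵇ-refl : ∀ a → eqListᵇ a a ≡ true
eqListᵇ-refl []      = refl
eqListᵇ-refl (x ∷ a) = ∧-true⁺ (≡⇒≡ᵇ-true {x} refl) (eqListᵇ-refl a)

sameMono⇒≋ : ∀ u v → sameMono u v ≡ true → u ≋ v
sameMono⇒≋ u v p =
  ≋-trans (≋-sym (norm-≋ u)) (subst (_≋ v) (sym (eqListᵇ-true⇒≡ (norm u) (norm v) p)) (norm-≋ v))

≋⇒sameMono : ∀ {u v} → u ≋ v → sameMono u v ≡ true
≋⇒sameMono {u} {v} p = subst (λ z → eqListᵇ (norm u) z ≡ true) (norm-cong p) (eqListᵇ-refl (norm u))

sameMono-cong : ∀ {u u′ v v′} → u ≋ u′ → v ≋ v′ → sameMono u v ≡ sameMono u′ v′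
sameMono-cong {u} {u′} {v} {v′} p q = bool-≡
  (λ h → ≋⇒sameMono {u′} {v′} (≋-trans (≋-sym p) (≋-trans (sameMono⇒≋ u v h) q)))
  (λ h → ≋⇒sameMono {u} {v} (≋-trans p (≋-trans (sameMono⇒≋ u′ v′ h) (≋-sym q))))

sameMono-∷ : ∀ v a q → sameMono v (a ∷ q) ≡ ((exponent 0 v ≡ᵇ a) ∧ sameMono (tailᵉ v) q)
sameMono-∷ v a q = bool-≡
  (λ h → let p = sameMono⇒≋ v (a ∷ q) h in
    ∧-true⁺ (≡⇒≡ᵇ-true (at p 0))
            (≋⇒sameMono {tailᵉ v} {q} (pointwise λ i → trans (sym (exponent-suc i v)) (at p (suc i)))))
  (λ h → let (p₀ , p) = ∧-true⁻ h in
    ≋⇒sameMono {v} {a ∷ q} (pointwise λ where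
      zero    → ≡ᵇ-true⇒≡ p₀
      (suc i) → trans (exponent-suc i v) (at (sameMono⇒≋ (tailᵉ v) q p) i)))

infixl 7 _*ᵐ_ _/ᵐ_
infix 4 _∣ᵐ_

_*ᵐ_ : Mono → Mono → Mono
[]      *ᵐ v = v
(x ∷ u) *ᵐ v = (x + exponent 0 v) ∷ (u *ᵐ tailᵉ v)

-- exact only when the divisor divides (truncated subtraction)
_/ᵐ_ : Mono → Mono → Mono
[]      /ᵐ v = []
(a ∷ E) /ᵐ v = (a ∸ exponent 0 v) ∷ (E /ᵐ tailᵉ v)

_∣ᵐ_ : Mono → Mono → Bool
v ∣ᵐ []      = sameMono v []
v ∣ᵐ (a ∷ E) = (exponent 0 v ≤ᵇ a) ∧ (tailᵉ v ∣ᵐ E)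

exponent-*ᵐ : ∀ i u v → exponent i (u *ᵐ v) ≡ exponent i u + exponent i v
exponent-*ᵐ i       []      v = refl
exponent-*ᵐ zero    (x ∷ u) v = refl
exponent-*ᵐ (suc i) (x ∷ u) v =
  trans (exponent-*ᵐ i u (tailᵉ v)) (cong (_+_ (exponent i u)) (sym (exponent-suc i v)))

exponent-/ᵐ : ∀ i E v → exponent i (E /ᵐ v) ≡ exponent i E ∸ exponent i v
exponent-/ᵐ i       []      v = sym (0∸n≡0 (exponent i v))
exponent-/ᵐ zero    (a ∷ E) v = refl
exponent-/ᵐ (suc i) (a ∷ E) v =
  trans (exponent-/ᵐ i E (tailᵉ v)) (cong (_∸_ (exponent i E)) (sym (exponent-suc i v)))

*ᵐ-comm : ∀ u v → u *ᵐ v ≋ v *ᵐ u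
*ᵐ-comm u v = pointwise λ i →
  trans (exponent-*ᵐ i u v) (trans (+-comm (exponent i u) _) (sym (exponent-*ᵐ i v u)))

*ᵐ-cong : ∀ {u u′ v v′} → u ≋ u′ → v ≋ v′ → u *ᵐ v ≋ u′ *ᵐ v′
*ᵐ-cong {u} {u′} {v} {v′} p q = pointwise λ i →
  trans (exponent-*ᵐ i u v) (trans (cong₂ _+_ (at p i) (at q i)) (sym (exponent-*ᵐ i u′ v′)))

/ᵐ-congˡ : ∀ {E E′} v → E ≋ E′ → E /ᵐ v ≋ E′ /ᵐ v
/ᵐ-congˡ {E} {E′} v p = pointwise λ i →
  trans (exponent-/ᵐ i E v) (trans (cong (_∸ exponent i v) (at p i)) (sym (exponent-/ᵐ i E′ v)))

/ᵐ-[] : ∀ E → E /ᵐ [] ≋ E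
/ᵐ-[] E = pointwise λ i → exponent-/ᵐ i E []

∣ᵐ⇒≤ : ∀ v E → (v ∣ᵐ E) ≡ true → ∀ i → exponent i v ≤ exponent i E
∣ᵐ⇒≤ v []      p i = subst (_≤ 0) (sym (at (sameMono⇒≋ v [] p) i)) z≤n
∣ᵐ⇒≤ v (a ∷ E) p zero    = ≤ᵇ-true⇒≤ (proj₁ (∧-true⁻ p))
∣ᵐ⇒≤ v (a ∷ E) p (suc i) =
  subst (_≤ exponent i E) (sym (exponent-suc i v)) (∣ᵐ⇒≤ (tailᵉ v) E (proj₂ (∧-true⁻ p)) i)

≤⇒∣ᵐ : ∀ v E → (∀ i → exponent i v ≤ exponent i E) → (v ∣ᵐ E) ≡ true
≤⇒∣ᵐ v []      p = ≋⇒sameMono {v} {[]} (pointwise λ i → n≤0⇒n≡0 (p i))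
  where
  n≤0⇒n≡0 : ∀ {n} → n ≤ 0 → n ≡ 0
  n≤0⇒n≡0 z≤n = refl
≤⇒∣ᵐ v (a ∷ E) p = ∧-true⁺ (≤⇒≤ᵇ-true (p 0))
  (≤⇒∣ᵐ (tailᵉ v) E λ i → subst (_≤ exponent i E) (exponent-suc i v) (p (suc i)))

∣ᵐ-congʳ : ∀ v {E E′} → E ≋ E′ → (v ∣ᵐ E) ≡ (v ∣ᵐ E′)
∣ᵐ-congʳ v {E} {E′} p = bool-≡
  (λ h → ≤⇒∣ᵐ v E′ λ i → subst (exponent i v ≤_) (at p i) (∣ᵐ⇒≤ v E h i))
  (λ h → ≤⇒∣ᵐ v E λ i → subst (exponent i v ≤_) (sym (at p i)) (∣ᵐ⇒≤ v E′ h i))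

[]∣ᵐ : ∀ E → ([] ∣ᵐ E) ≡ true
[]∣ᵐ E = ≤⇒∣ᵐ [] E λ _ → z≤n

sameMono-*ᵐ : ∀ u v E → sameMono (u *ᵐ v) E ≡ (if v ∣ᵐ E then sameMono u (E /ᵐ v) else false)
sameMono-*ᵐ u v E with v ∣ᵐ E in v∣E
... | true = bool-≡
  (λ h → ≋⇒sameMono {u} {E /ᵐ v} (pointwise λ i → begin
      exponent i u                              ≡⟨ m+n∸n≡m (exponent i u) (exponent i v) ⟨
      exponent i u + exponent i v ∸ exponent i v ≡⟨ cong (_∸ exponent i v) (exponent-*ᵐ i u v) ⟨
      exponent i (u *ᵐ v) ∸ exponent i v        ≡⟨ cong (_∸ exponent i v) (at (sameMono⇒≋ (u *ᵐ v) E h) i) ⟩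
      exponent i E ∸ exponent i v               ≡⟨ exponent-/ᵐ i E v ⟨
      exponent i (E /ᵐ v)                       ∎))
  (λ h → ≋⇒sameMono {u *ᵐ v} {E} (pointwise λ i → begin
      exponent i (u *ᵐ v)                       ≡⟨ exponent-*ᵐ i u v ⟩
      exponent i u + exponent i v               ≡⟨ cong (_+ exponent i v) (at (sameMono⇒≋ u (E /ᵐ v) h) i) ⟩
      exponent i (E /ᵐ v) + exponent i v        ≡⟨ cong (_+ exponent i v) (exponent-/ᵐ i E v) ⟩
      exponent i E ∸ exponent i v + exponent i v ≡⟨ m∸n+n≡m (∣ᵐ⇒≤ v E v∣E i) ⟩
      exponent i E                              ∎))
  where open ≡-Reasoning
... | false = bool-≡ (λ h → trans (sym v∣E) (≤⇒∣ᵐ v E λ i →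
        subst (exponent i v ≤_) (trans (sym (exponent-*ᵐ i u v)) (at (sameMono⇒≋ (u *ᵐ v) E h) i))
              (m≤n+m (exponent i v) (exponent i u))))
  (λ ())

sumOver : ∀ {A : Set} → (A → ℤ) → List A → ℤ
sumOver f xs = sumℤ (map f xs)

sumOver-++ : ∀ {A : Set} (f : A → ℤ) xs ys → sumOver f (xs ++ ys) ≡ sumOver f xs +ℤ sumOver f ys
sumOver-++ f []       ys = sym (ℤ.+-identityˡ _)
sumOver-++ f (x ∷ xs) ys = trans (cong (f x +ℤ_) (sumOver-++ f xs ys)) (sym (ℤ.+-assoc (f x) _ _))

sumOver-map : ∀ {A B : Set} (f : B → ℤ) (g : A → B) xs → sumOver f (map g xs) ≡ sumOver (λ x → f (g x)) xs
sumOver-map f g xs = cong sumℤ (sym (map-∘ xs))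

sumOver-cong : ∀ {A : Set} {f g : A → ℤ} xs → (∀ x → f x ≡ g x) → sumOver f xs ≡ sumOver g xs
sumOver-cong xs f≗g = cong sumℤ (map-cong f≗g xs)

sumOver-concatMap : ∀ {A B : Set} (f : B → ℤ) (h : A → List B) xs →
  sumOver f (concatMap h xs) ≡ sumOver (λ x → sumOver f (h x)) xs
sumOver-concatMap f h []       = refl
sumOver-concatMap f h (x ∷ xs) =
  trans (sumOver-++ f (h x) (concatMap h xs)) (cong (sumOver f (h x) +ℤ_) (sumOver-concatMap f h xs))

sumOver-zero : ∀ {A : Set} (xs : List A) → sumOver (λ _ → 0ℤ) xs ≡ 0ℤ
sumOver-zero []       = refl
sumOver-zero (x ∷ xs) = trans (ℤ.+-identityˡ _) (sumOver-zero xs)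

sumOver-+ : ∀ {A : Set} (f g : A → ℤ) xs → sumOver (λ x → f x +ℤ g x) xs ≡ sumOver f xs +ℤ sumOver g xs
sumOver-+ f g []       = refl
sumOver-+ f g (x ∷ xs) rewrite sumOver-+ f g xs = ℤ+.interchange (f x) (g x) (sumOver f xs) (sumOver g xs)

sumOver-difference : ∀ {A : Set} (f g : A → ℤ) xs → sumOver (λ x → f x -ℤ g x) xs ≡ sumOver f xs -ℤ sumOver g xs
sumOver-difference f g []       = refl
sumOver-difference f g (x ∷ xs) rewrite sumOver-difference f g xs = regroup (f x) (g x) (sumOver f xs) (sumOver g xs)
  where
  regroup : ∀ (a b c d : ℤ) → (a -ℤ b) +ℤ (c -ℤ d) ≡ (a +ℤ c) -ℤ (b +ℤ d)
  regroup = solve-∀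

sumOver-*ʳ : ∀ {A : Set} (f : A → ℤ) c xs → sumOver f xs *ℤ c ≡ sumOver (λ x → f x *ℤ c) xs
sumOver-*ʳ f c []       = ℤ.*-zeroˡ c
sumOver-*ʳ f c (x ∷ xs) =
  trans (ℤ.*-distribʳ-+ c (f x) (sumOver f xs)) (cong (f x *ℤ c +ℤ_) (sumOver-*ʳ f c xs))

sumOver-*ˡ : ∀ {A : Set} (f : A → ℤ) c xs → c *ℤ sumOver f xs ≡ sumOver (λ x → c *ℤ f x) xs
sumOver-*ˡ f c []       = ℤ.*-zeroʳ c
sumOver-*ˡ f c (x ∷ xs) =
  trans (ℤ.*-distribˡ-+ c (f x) (sumOver f xs)) (cong (c *ℤ f x +ℤ_) (sumOver-*ˡ f c xs))

sumOver-swap : ∀ {A B : Set} (f : A → B → ℤ) xs ys →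
  sumOver (λ x → sumOver (f x) ys) xs ≡ sumOver (λ y → sumOver (λ x → f x y) xs) ys
sumOver-swap f []       ys = sym (sumOver-zero ys)
sumOver-swap f (x ∷ xs) ys =
  trans (cong (sumOver (f x) ys +ℤ_) (sumOver-swap f xs ys))
        (sym (sumOver-+ (f x) (λ y → sumOver (λ x → f x y) xs) ys))

sumOver-cartesianProduct : ∀ {A B : Set} (f : A × B → ℤ) xs ys →
  sumOver f (cartesianProduct xs ys) ≡ sumOver (λ x → sumOver (λ y → f (x , y)) ys) xs
sumOver-cartesianProduct f []       ys = refl
sumOver-cartesianProduct f (x ∷ xs) ys =
  trans (sumOver-++ f (map (x ,_) ys) _) (cong₂ _+ℤ_ (sumOver-map f (x ,_) ys) (sumOver-cartesianProduct f xs ys))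

sumBelow : ℕ → (ℕ → ℤ) → ℤ
sumBelow zero    f = 0ℤ
sumBelow (suc n) f = sumBelow n f +ℤ f n

sumOver-applyUpTo : ∀ (f : ℕ → ℤ) (g : ℕ → ℕ) n → sumOver f (applyUpTo g n) ≡ sumBelow n (λ i → f (g i))
sumOver-applyUpTo f g zero    = refl
sumOver-applyUpTo f g (suc n) =
  trans (cong (f (g 0) +ℤ_) (sumOver-applyUpTo f (λ i → g (suc i)) n)) (peel n (λ i → f (g i)))
  where
  peel : ∀ n (h : ℕ → ℤ) → h 0 +ℤ sumBelow n (λ i → h (suc i)) ≡ sumBelow (suc n) h
  peel zero    h = trans (ℤ.+-identityʳ (h 0)) (sym (ℤ.+-identityˡ (h 0)))
  peel (suc n) h = trans (sym (ℤ.+-assoc (h 0) _ _)) (cong (_+ℤ h (suc n)) (peel n h))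

sumBelow-cong : ∀ n {f g : ℕ → ℤ} → (∀ i → i < n → f i ≡ g i) → sumBelow n f ≡ sumBelow n g
sumBelow-cong zero    _   = refl
sumBelow-cong (suc n) f≗g = cong₂ _+ℤ_ (sumBelow-cong n λ i i<n → f≗g i (m<n⇒m<1+n i<n)) (f≗g n ≤-refl)

sumBelow-indicator : ∀ n k (X : ℕ → ℤ) →
  sumBelow n (λ i → if i ≡ᵇ k then X i else 0ℤ) ≡ (if k <ᵇ n then X k else 0ℤ)
sumBelow-indicator zero    k X = refl
sumBelow-indicator (suc n) k X with <-cmp k n
... | tri< k<n k≢n _ rewrite sumBelow-indicator n k X | <⇒<ᵇ-true k<n | <⇒<ᵇ-true (m<n⇒m<1+n k<n)
                           | ≢⇒≡ᵇ-false (λ n≡k → k≢n (sym n≡k)) = ℤ.+-identityʳ (X k)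
... | tri≈ _ refl _ rewrite sumBelow-indicator n k X | ≮⇒<ᵇ-false (n≮n k) | <⇒<ᵇ-true (n<1+n k)
                           | ≡⇒≡ᵇ-true {k} refl = ℤ.+-identityˡ (X k)
... | tri> _ k≢n n<k rewrite sumBelow-indicator n k X | ≮⇒<ᵇ-false (<⇒≯ n<k)
                           | ≮⇒<ᵇ-false {k} {suc n} (λ k<1+n → <⇒≯ n<k (≤∧≢⇒< (≤-pred k<1+n) k≢n))
                           | ≢⇒≡ᵇ-false (λ n≡k → k≢n (sym n≡k)) = refl

sumBelow-reflected-indicator : ∀ h a (X : ℕ → ℤ) →
  sumBelow (suc a) (λ i → if h ≡ᵇ a ∸ i then X i else 0ℤ) ≡ (if h ≤ᵇ a then X (a ∸ h) else 0ℤ)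
sumBelow-reflected-indicator h a X with h ≤ᵇ a in h≤ᵇa
... | true = begin
    sumBelow (suc a) (λ i → if h ≡ᵇ a ∸ i then X i else 0ℤ)  ≡⟨ sumBelow-cong (suc a) reflect ⟩
    sumBelow (suc a) (λ i → if i ≡ᵇ a ∸ h then X i else 0ℤ)  ≡⟨ sumBelow-indicator (suc a) (a ∸ h) X ⟩
    (if a ∸ h <ᵇ suc a then X (a ∸ h) else 0ℤ)
      ≡⟨ cong (if_then X (a ∸ h) else 0ℤ) (<⇒<ᵇ-true (s≤s (m∸n≤m a h))) ⟩
    X (a ∸ h)                                                 ∎
  where
  open ≡-Reasoning
  reflect : ∀ i → i < suc a → (if h ≡ᵇ a ∸ i then X i else 0ℤ) ≡ (if i ≡ᵇ a ∸ h then X i else 0ℤ)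
  reflect i i≤a = cong (if_then X i else 0ℤ) (bool-≡
    (λ p → ≡⇒≡ᵇ-true (trans (sym (m∸[m∸n]≡n (≤-pred i≤a))) (cong (a ∸_) (sym (≡ᵇ-true⇒≡ {h} p)))))
    (λ p → ≡⇒≡ᵇ-true {h} (trans (sym (m∸[m∸n]≡n (≤ᵇ-true⇒≤ {h} h≤ᵇa)))
                                (cong (a ∸_) (sym (≡ᵇ-true⇒≡ {i} p))))))
... | false = trans (sumBelow-cong (suc a) vanish) (sumBelow-zero (suc a))
  where
  vanish : ∀ i → i < suc a → (if h ≡ᵇ a ∸ i then X i else 0ℤ) ≡ 0ℤ
  vanish i _ with h ≡ᵇ a ∸ i in h≡a∸i
  ... | false = refl
  ... | true  with () ← trans (sym (≤⇒≤ᵇ-true (subst (_≤ a) (sym (≡ᵇ-true⇒≡ {h} h≡a∸i)) (m∸n≤m a i)))) h≤ᵇa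
  sumBelow-zero : ∀ n → sumBelow n (λ _ → 0ℤ) ≡ 0ℤ
  sumBelow-zero zero    = refl
  sumBelow-zero (suc n) = trans (ℤ.+-identityʳ _) (sumBelow-zero n)

sumOver-splits : ∀ a E (f : Mono × Mono → ℤ) → sumOver f (splits (a ∷ E)) ≡
  sumBelow (suc a) (λ i → sumOver (λ q → f ((i ∷ proj₁ q) , ((a ∸ i) ∷ proj₂ q))) (splits E))
sumOver-splits a E f =
  trans (sumOver-concatMap f (λ i → map (λ p → (i ∷ proj₁ p) , ((a ∸ i) ∷ proj₂ p)) (splits E)) (upTo (suc a)))
  (trans (sumOver-cong (upTo (suc a)) (λ i → sumOver-map f _ (splits E)))
         (sumOver-applyUpTo _ (λ i → i) (suc a)))

-- the coefficient of E in g ⊛ mono v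
sumOver-splits-sameMono : ∀ E v (g : Mono → ℤ) →
  sumOver (λ p → g (proj₁ p) *ℤ boolℤ (sameMono v (proj₂ p))) (splits E) ≡ (if v ∣ᵐ E then g (E /ᵐ v) else 0ℤ)
sumOver-splits-sameMono [] v g with sameMono v []
... | true  = trans (ℤ.+-identityʳ _) (ℤ.*-identityʳ (g []))
... | false = trans (ℤ.+-identityʳ _) (ℤ.*-zeroʳ (g []))
sumOver-splits-sameMono (a ∷ E) v g = begin
  _                                                                ≡⟨ sumOver-splits a E _ ⟩
  sumBelow (suc a) _                                               ≡⟨ sumBelow-cong (suc a) headCase ⟩
  sumBelow (suc a) (λ i → if exponent 0 v ≡ᵇ a ∸ i then X i else 0ℤ) ≡⟨ sumBelow-reflected-indicator (exponent 0 v) a X ⟩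
  (if exponent 0 v ≤ᵇ a then X (a ∸ exponent 0 v) else 0ℤ)          ≡⟨ if-∧ (exponent 0 v ≤ᵇ a) ⟨
  (if v ∣ᵐ (a ∷ E) then g ((a ∷ E) /ᵐ v) else 0ℤ)                  ∎
  where
  open ≡-Reasoning
  X : ℕ → ℤ
  X i = if tailᵉ v ∣ᵐ E then g (i ∷ (E /ᵐ tailᵉ v)) else 0ℤ
  sameMono-head : ∀ {i c} q → (exponent 0 v ≡ᵇ a ∸ i) ≡ c → sameMono v ((a ∸ i) ∷ q) ≡ (c ∧ sameMono (tailᵉ v) q)
  sameMono-head {i} q eq = trans (sameMono-∷ v (a ∸ i) q) (cong (_∧ sameMono (tailᵉ v) q) eq)
  headCase : ∀ i → i < suc a →
    sumOver (λ q → g (i ∷ proj₁ q) *ℤ boolℤ (sameMono v ((a ∸ i) ∷ proj₂ q))) (splits E)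
    ≡ (if exponent 0 v ≡ᵇ a ∸ i then X i else 0ℤ)
  headCase i _ with exponent 0 v ≡ᵇ a ∸ i in eq
  ... | true  = trans (sumOver-cong (splits E) λ q → cong (λ b → g (i ∷ proj₁ q) *ℤ boolℤ b) (sameMono-head {i} (proj₂ q) eq))
                      (sumOver-splits-sameMono E (tailᵉ v) (λ p → g (i ∷ p)))
  ... | false = trans (sumOver-cong (splits E) λ q → trans (cong (λ b → g (i ∷ proj₁ q) *ℤ boolℤ b) (sameMono-head {i} (proj₂ q) eq))
                                                          (ℤ.*-zeroʳ (g (i ∷ proj₁ q))))
                      (sumOver-zero (splits E))
  if-∧ : ∀ b → (if b ∧ (tailᵉ v ∣ᵐ E) then g ((a ∷ E) /ᵐ v) else 0ℤ) ≡ (if b then X (a ∸ exponent 0 v) else 0ℤ)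
  if-∧ true  = refl
  if-∧ false = refl

countᵇ : ∀ {A : Set} → (A → Bool) → List A → ℕ
countᵇ p []       = 0
countᵇ p (x ∷ xs) = if p x then suc (countᵇ p xs) else countᵇ p xs

length-filter : ∀ {A : Set} (p : A → Bool) xs → length (filter (λ x → p x ≟B true) xs) ≡ countᵇ p xs
length-filter p []       = refl
length-filter p (x ∷ xs) with p x
... | true  = cong suc (length-filter p xs)
... | false = length-filter p xs

countᵇ-sumOver : ∀ {A : Set} (p : A → Bool) xs → + countᵇ p xs ≡ sumOver (λ x → boolℤ (p x)) xs
countᵇ-sumOver p []       = refl
countᵇ-sumOver p (x ∷ xs) with p x
... | true  = trans (cong (1ℤ +ℤ_) (countᵇ-sumOver p xs)) refl
... | false = trans (countᵇ-sumOver p xs) (sym (ℤ.+-identityˡ _))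

+countᵇ-∷ : ∀ {A : Set} (p : A → Bool) x xs → + countᵇ p (x ∷ xs) ≡ boolℤ (p x) +ℤ + countᵇ p xs
+countᵇ-∷ p x xs with p x
... | true  = refl
... | false = sym (ℤ.+-identityˡ _)

countᵇ-++ : ∀ {A : Set} (p : A → Bool) xs ys → countᵇ p (xs ++ ys) ≡ countᵇ p xs + countᵇ p ys
countᵇ-++ p []       ys = refl
countᵇ-++ p (x ∷ xs) ys with p x
... | true  = cong suc (countᵇ-++ p xs ys)
... | false = countᵇ-++ p xs ys

countᵇ-map : ∀ {A B : Set} (p : B → Bool) (h : A → B) xs → countᵇ p (map h xs) ≡ countᵇ (λ x → p (h x)) xs
countᵇ-map p h []       = refl
countᵇ-map p h (x ∷ xs) with p (h x)
... | true  = cong suc (countᵇ-map p h xs)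
... | false = countᵇ-map p h xs

countᵇ-cong : ∀ {A : Set} {p q : A → Bool} xs → (∀ {x} → x ∈ xs → p x ≡ q x) → countᵇ p xs ≡ countᵇ q xs
countᵇ-cong         []       _   = refl
countᵇ-cong {q = q} (x ∷ xs) p≗q rewrite p≗q (here refl) with q x
... | true  = cong suc (countᵇ-cong xs (p≗q ∘ there))
... | false = countᵇ-cong xs (p≗q ∘ there)

countᵇ-none : ∀ {A : Set} (p : A → Bool) xs → (∀ {x} → x ∈ xs → p x ≡ false) → countᵇ p xs ≡ 0
countᵇ-none p []       _    = refl
countᵇ-none p (x ∷ xs) none rewrite none (here refl) = countᵇ-none p xs (none ∘ there)

countᵇ-if : ∀ {A : Set} b (p : A → Bool) xs → countᵇ (λ x → if b then p x else false) xs ≡ (if b then countᵇ p xs else 0)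
countᵇ-if true  p xs = refl
countᵇ-if false p xs = countᵇ-none _ xs λ _ → refl

countᵇ-filter : ∀ {A : Set} (f p : A → Bool) xs →
  countᵇ p (filter (λ x → f x ≟B true) xs) ≡ countᵇ (λ x → f x ∧ p x) xs
countᵇ-filter f p []       = refl
countᵇ-filter f p (x ∷ xs) with f x
... | false = countᵇ-filter f p xs
... | true with p x
...   | true  = cong suc (countᵇ-filter f p xs)
...   | false = countᵇ-filter f p xs

countᵇ-middle : ∀ {A : Set} (p : A → Bool) ys x zs → countᵇ p (ys ++ x ∷ zs) ≡ countᵇ p (x ∷ ys ++ zs)
countᵇ-middle p []       x zs = refl
countᵇ-middle p (y ∷ ys) x zs rewrite countᵇ-middle p ys x zs with p y | p x
... | true  | true  = refl
... | true  | false = refl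
... | false | true  = refl
... | false | false = refl

Unique-remove : ∀ {A : Set} (ys : List A) {x zs} → Unique (ys ++ x ∷ zs) → Unique (ys ++ zs) × x ∉ ys ++ zs
Unique-remove []       (x∉zs ∷ u) = u , All.All¬⇒¬Any x∉zs
Unique-remove (y ∷ ys) (y∉ ∷ u) with Unique-remove ys u
... | u′ , x∉ = (All.++⁺ (All.++⁻ˡ ys y∉) (All.tail (All.++⁻ʳ ys y∉)) ∷ u′)
              , λ { (here refl) → All.head (All.++⁻ʳ ys y∉) refl ; (there m) → x∉ m }

∈-remove : ∀ {A : Set} (ys : List A) {x zs z} → z ∈ ys ++ x ∷ zs → z ≡ x ⊎ z ∈ ys ++ zs
∈-remove []       (here refl) = inj₁ refl
∈-remove []       (there m)   = inj₂ m
∈-remove (y ∷ ys) (here refl) = inj₂ (here refl)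
∈-remove (y ∷ ys) (there m)   = Sum.map₂ there (∈-remove ys m)

∈-insert : ∀ {A : Set} (ys : List A) {x zs z} → z ∈ ys ++ zs → z ∈ ys ++ x ∷ zs
∈-insert []       m           = there m
∈-insert (y ∷ ys) (here refl) = here refl
∈-insert (y ∷ ys) (there m)   = there (∈-insert ys m)

-- two duplicate-free lists with the same members are permutations of each other
countᵇ-sameMembers : ∀ {A : Set} (p : A → Bool) xs ys → Unique xs → Unique ys →
  (∀ {z} → z ∈ xs → z ∈ ys) → (∀ {z} → z ∈ ys → z ∈ xs) → countᵇ p xs ≡ countᵇ p ys
countᵇ-sameMembers p []       []       _ _ _ _ = refl
countᵇ-sameMembers p []       (y ∷ ys) _ _ _ ys⊆xs with () ← ys⊆xs (here refl)
countᵇ-sameMembers p (x ∷ xs) ys (x∉xs ∷ uxs) uys xs⊆ys ys⊆xs with ∈-∃++ (xs⊆ys (here refl))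
... | ys₁ , ys₂ , refl with Unique-remove ys₁ uys
... | uys′ , x∉ys′ =
  trans (cong (λ c → if p x then suc c else c) rest) (sym (countᵇ-middle p ys₁ x ys₂))
  where
  rest : countᵇ p xs ≡ countᵇ p (ys₁ ++ ys₂)
  rest = countᵇ-sameMembers p xs (ys₁ ++ ys₂) uxs uys′
    (λ m → Sum.[ (λ z≡x → ⊥-elim (All.lookup x∉xs m (sym z≡x))) , id ] (∈-remove ys₁ (xs⊆ys (there m))))
    (λ {z} m → case ys⊆xs (∈-insert ys₁ m) of λ where
      (here refl) → ⊥-elim (x∉ys′ m)
      (there m′)  → m′)

-- Truncating at x₁-degree K is what lets finite lists stand for the infinite sets of words.
record Enumerates {A : Set} (K : ℕ) (f : FPS) (X : List A) (w : A → Mono) : Set where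
  constructor enumerates
  field coefficient : ∀ e → exponent 0 e ≤ K → f (norm e) ≡ + countᵇ (λ x → sameMono (w x) e) X
open Enumerates public

sumOver-splits-cong : ∀ E (f g : Mono × Mono → ℤ) →
  (∀ p₁ p₂ → exponent 0 p₁ ≤ exponent 0 E → exponent 0 p₂ ≤ exponent 0 E → f (p₁ , p₂) ≡ g (p₁ , p₂)) →
  sumOver f (splits E) ≡ sumOver g (splits E)
sumOver-splits-cong []      f g f≗g = cong (_+ℤ 0ℤ) (f≗g [] [] z≤n z≤n)
sumOver-splits-cong (a ∷ E) f g f≗g =
  trans (sumOver-splits a E f) (trans
    (sumBelow-cong (suc a) λ i i≤a → sumOver-cong (splits E) λ q → f≗g _ _ (≤-pred i≤a) (m∸n≤m a i))
    (sym (sumOver-splits a E g)))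

sumOver-*-sumOver : ∀ {A B : Set} (f : A → ℤ) (g : B → ℤ) xs ys →
  sumOver f xs *ℤ sumOver g ys ≡ sumOver (λ x → sumOver (λ y → f x *ℤ g y) ys) xs
sumOver-*-sumOver f g xs ys =
  trans (sumOver-*ʳ f (sumOver g ys) xs) (sumOver-cong xs λ x → sumOver-*ˡ g (f x) ys)

-- mono u ⊛ mono v = mono (u *ᵐ v)
sumOver-splits-product : ∀ u v E →
  sumOver (λ p → boolℤ (sameMono u (proj₁ p)) *ℤ boolℤ (sameMono v (proj₂ p))) (splits E)
  ≡ boolℤ (sameMono (u *ᵐ v) E)
sumOver-splits-product u v E =
  trans (sumOver-splits-sameMono E v (λ p → boolℤ (sameMono u p)))
        (trans (boolℤ-if (v ∣ᵐ E)) (cong boolℤ (sym (sameMono-*ᵐ u v E))))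
  where
  boolℤ-if : ∀ b → (if b then boolℤ (sameMono u (E /ᵐ v)) else 0ℤ) ≡ boolℤ (if b then sameMono u (E /ᵐ v) else false)
  boolℤ-if true  = refl
  boolℤ-if false = refl

Enumerates-⊛ : ∀ {A B : Set} {K f g} {X : List A} {Y : List B} {u : A → Mono} {v : B → Mono} →
  Enumerates K f X u → Enumerates K g Y v →
  Enumerates K (f ⊛ g) (cartesianProduct X Y) (λ xy → u (proj₁ xy) *ᵐ v (proj₂ xy))
Enumerates-⊛ {A} {B} {K} {f} {g} {X} {Y} {u} {v} enumF enumG = enumerates coefficient-⊛
  where
  coefficient-⊛ : ∀ e → exponent 0 e ≤ K →
    (f ⊛ g) (norm e) ≡ + countᵇ (λ xy → sameMono (u (proj₁ xy) *ᵐ v (proj₂ xy)) e) (cartesianProduct X Y)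
  coefficient-⊛ e e≤K = begin
    sumOver (λ p → f (norm (proj₁ p)) *ℤ g (norm (proj₂ p))) (splits E)
      ≡⟨ sumOver-splits-cong E _ _ (λ p₁ p₂ b₁ b₂ → cong₂ _*ℤ_ (countF p₁ b₁) (countG p₂ b₂)) ⟩
    sumOver (λ p → sumOver (λ x → δ (u x) (proj₁ p)) X *ℤ sumOver (λ y → δ (v y) (proj₂ p)) Y) (splits E)
      ≡⟨ sumOver-cong (splits E) (λ p → sumOver-*-sumOver _ _ X Y) ⟩
    sumOver (λ p → sumOver (λ x → sumOver (λ y → term x y p) Y) X) (splits E)
      ≡⟨ sumOver-swap _ (splits E) X ⟩
    sumOver (λ x → sumOver (λ p → sumOver (λ y → term x y p) Y) (splits E)) X
      ≡⟨ sumOver-cong X (λ x → sumOver-swap _ (splits E) Y) ⟩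
    sumOver (λ x → sumOver (λ y → sumOver (term x y) (splits E)) Y) X
      ≡⟨ sumOver-cong X (λ x → sumOver-cong Y λ y → trans (sumOver-splits-product (u x) (v y) E)
                                                           (cong boolℤ (sameMono-cong (≋-refl {u x *ᵐ v y}) E≋e))) ⟩
    sumOver (λ x → sumOver (λ y → δ (u x *ᵐ v y) e) Y) X
      ≡⟨ sumOver-cartesianProduct (λ xy → δ (u (proj₁ xy) *ᵐ v (proj₂ xy)) e) X Y ⟨
    sumOver (λ xy → δ (u (proj₁ xy) *ᵐ v (proj₂ xy)) e) (cartesianProduct X Y)
      ≡⟨ countᵇ-sumOver _ (cartesianProduct X Y) ⟨
    + countᵇ (λ xy → sameMono (u (proj₁ xy) *ᵐ v (proj₂ xy)) e) (cartesianProduct X Y) ∎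
    where
    open ≡-Reasoning
    δ : Mono → Mono → ℤ
    δ w q = boolℤ (sameMono w q)
    term : A → B → Mono × Mono → ℤ
    term x y p = δ (u x) (proj₁ p) *ℤ δ (v y) (proj₂ p)
    E : Mono
    E = norm (norm e)
    E≋e : E ≋ e
    E≋e = ≋-trans (norm-≋ (norm e)) (norm-≋ e)
    bounded : ∀ q → exponent 0 q ≤ exponent 0 E → exponent 0 q ≤ K
    bounded q q≤E = ≤-trans q≤E (subst (_≤ K) (sym (at E≋e 0)) e≤K)
    countF : ∀ q → exponent 0 q ≤ exponent 0 E → f (norm q) ≡ sumOver (λ x → δ (u x) q) X
    countF q b = trans (coefficient enumF q (bounded q b)) (countᵇ-sumOver _ X)
    countG : ∀ q → exponent 0 q ≤ exponent 0 E → g (norm q) ≡ sumOver (λ y → δ (v y) q) Y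
    countG q b = trans (coefficient enumG q (bounded q b)) (countᵇ-sumOver _ Y)

Enumerates-map : ∀ {A B : Set} {K f} {X : List A} {w : A → Mono} (h : A → B) (w′ : B → Mono) →
  Enumerates K f X w → (∀ {x} → x ∈ X → w x ≋ w′ (h x)) → Enumerates K f (map h X) w′
Enumerates-map {X = X} h w′ enum w≋w′ = enumerates λ e e≤K →
  trans (coefficient enum e e≤K) (cong +_ (trans (countᵇ-cong X λ x∈X → sameMono-cong (w≋w′ x∈X) (≋-refl {e}))
                                     (sym (countᵇ-map _ h X))))

Enumerates-mono : ∀ {K} v → Enumerates K (mono v) (tt ∷ []) (λ _ → v)
Enumerates-mono v = enumerates λ e _ → lemma e (sameMono v e) (sameMono-cong {v} ≋-refl (norm-≋ e))
  where
  lemma : ∀ e b → sameMono v (norm e) ≡ b → mono v (norm e) ≡ + countᵇ (λ _ → b) (tt ∷ [])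
  lemma e true  eq = cong boolℤ eq
  lemma e false eq = cong boolℤ eq

countᵇ-sameMono-*ᵐ : ∀ {A : Set} v (w : A → Mono) e xs →
  countᵇ (λ x → sameMono (v *ᵐ w x) e) xs ≡ (if v ∣ᵐ e then countᵇ (λ x → sameMono (w x) (e /ᵐ v)) xs else 0)
countᵇ-sameMono-*ᵐ v w e xs =
  trans (countᵇ-cong xs λ {x} _ → trans (sameMono-cong (*ᵐ-comm v (w x)) (≋-refl {e})) (sameMono-*ᵐ (w x) v e))
        (countᵇ-if (v ∣ᵐ e) _ xs)

coefficient-⊛-mono : ∀ (g : FPS) v e →
  sumOver (λ p → g (norm (proj₁ p)) *ℤ boolℤ (sameMono v (proj₂ p))) (splits (norm e))
  ≡ (if v ∣ᵐ e then g (norm (e /ᵐ v)) else 0ℤ)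
coefficient-⊛-mono g v e =
  trans (sumOver-splits-sameMono (norm e) v (g ∘ norm)) (divisible (v ∣ᵐ norm e) (∣ᵐ-congʳ v (norm-≋ e)))
  where
  divisible : ∀ b → b ≡ (v ∣ᵐ e) →
              (if b then g (norm (norm e /ᵐ v)) else 0ℤ) ≡ (if v ∣ᵐ e then g (norm (e /ᵐ v)) else 0ℤ)
  divisible true  eq rewrite sym eq = cong g (norm-cong (/ᵐ-congˡ v (norm-≋ e)))
  divisible false eq rewrite sym eq = refl

denom-norm : ∀ m q → denom m (norm q) ≡
  (boolℤ (sameMono [] q) -ℤ boolℤ (sameMono (aExp m) q)) -ℤ boolℤ (sameMono (bExp m) q)
denom-norm m q = cong₂ _-ℤ_ (cong₂ _-ℤ_ (atNorm³ []) (atNorm³ (aExp m))) (atNorm² (bExp m))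
  where
  atNorm² : ∀ v → mono v (norm (norm q)) ≡ boolℤ (sameMono v q)
  atNorm² v = cong boolℤ (sameMono-cong (≋-refl {v}) (≋-trans (norm-≋ (norm q)) (norm-≋ q)))
  atNorm³ : ∀ v → mono v (norm (norm (norm q))) ≡ boolℤ (sameMono v q)
  atNorm³ v = trans (cong (mono v) (norm-cong (norm-≋ (norm q)))) (atNorm² v)

-- G · (1 - a - b) = 1 read off coefficientwise: G = 1 + a G + b G
inverse-recurrence : ∀ G → AreInverses G → ∀ m → 1 ≤ m → ∀ e → G m (norm e) ≡
  (boolℤ (sameMono [] e) +ℤ (if aExp m ∣ᵐ e then G m (norm (e /ᵐ aExp m)) else 0ℤ))
                         +ℤ (if bExp m ∣ᵐ e then G m (norm (e /ᵐ bExp m)) else 0ℤ)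
inverse-recurrence G inverse m 1≤m e = rearrange (G m (norm e)) _ _ _ (begin
  (G m (norm e) -ℤ along (aExp m)) -ℤ along (bExp m)
    ≡⟨ cong₂ _-ℤ_ (cong₂ _-ℤ_ (sym (trans (coefficient-⊛-mono (G m) [] e) along-[]))
                              (sym (coefficient-⊛-mono (G m) (aExp m) e)))
                  (sym (coefficient-⊛-mono (G m) (bExp m) e)) ⟩
  (convolve [] -ℤ convolve (aExp m)) -ℤ convolve (bExp m)
    ≡⟨ cong (_-ℤ convolve (bExp m)) (sumOver-difference (term []) (term (aExp m)) (splits (norm e))) ⟨
  sumOver (λ p → term [] p -ℤ term (aExp m) p) (splits (norm e)) -ℤ convolve (bExp m)
    ≡⟨ sumOver-difference (λ p → term [] p -ℤ term (aExp m) p) (term (bExp m)) (splits (norm e)) ⟨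
  sumOver (λ p → (term [] p -ℤ term (aExp m) p) -ℤ term (bExp m) p) (splits (norm e))
    ≡⟨ sumOver-cong (splits (norm e)) (λ p → sym (trans (cong (G m (norm (proj₁ p)) *ℤ_) (denom-norm m (proj₂ p)))
                                                           (distrib (G m (norm (proj₁ p))) _ _ _))) ⟩
  (G m ⊛ denom m) e
    ≡⟨ inverse m 1≤m e ⟩
  one e ∎)
  where
  open ≡-Reasoning
  along : Mono → ℤ
  along v = if v ∣ᵐ e then G m (norm (e /ᵐ v)) else 0ℤ
  term : Mono → Mono × Mono → ℤ
  term v p = G m (norm (proj₁ p)) *ℤ boolℤ (sameMono v (proj₂ p))
  convolve : Mono → ℤ
  convolve v = sumOver (term v) (splits (norm e))
  along-[] : along [] ≡ G m (norm e)
  along-[] rewrite []∣ᵐ e = cong (G m) (norm-cong (/ᵐ-[] e))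
  distrib : ∀ (x y z w : ℤ) → x *ℤ ((y -ℤ z) -ℤ w) ≡ (x *ℤ y -ℤ x *ℤ z) -ℤ x *ℤ w
  distrib = solve-∀
  rearrange : ∀ (x y z c : ℤ) → (x -ℤ y) -ℤ z ≡ c → x ≡ (c +ℤ y) +ℤ z
  rearrange x y z c h = trans (cancel x y z) (cong (λ t → (t +ℤ y) +ℤ z) h)
    where
    cancel : ∀ (x y z : ℤ) → x ≡ (((x -ℤ y) -ℤ z) +ℤ y) +ℤ z
    cancel = solve-∀

data Letter : Set where
  single pair : Letter

Word : Set
Word = List Letter

letterWeight : ℕ → Letter → Mono
letterWeight m single = aExp m
letterWeight m pair   = bExp m

wordWeight : ℕ → Word → Mono
wordWeight m []      = []
wordWeight m (ℓ ∷ w) = letterWeight m ℓ *ᵐ wordWeight m w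

wordsUpTo : ℕ → List Word
wordsUpTo zero    = [] ∷ []
wordsUpTo (suc K) = [] ∷ (map (single ∷_) (wordsUpTo K) ++ map (pair ∷_) (wordsUpTo K))

-- each letter raises the degree in x₁, which is why wordsUpTo K suffices below degree K
1≤exponent₀-letterWeight : ∀ m ℓ → 1 ≤ exponent 0 (letterWeight (suc m) ℓ)
1≤exponent₀-letterWeight m single = s≤s z≤n
1≤exponent₀-letterWeight m pair   = s≤s z≤n

module _ (G : ℕ → FPS) (inverse : AreInverses G) (m : ℕ) where

  private
    hasWeight : Mono → Word → Bool
    hasWeight e w = sameMono (wordWeight (suc m) w) e

    along : Letter → Mono → ℤ
    along ℓ e = if letterWeight (suc m) ℓ ∣ᵐ e then G (suc m) (norm (e /ᵐ letterWeight (suc m) ℓ)) else 0ℤ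

    recurrence : ∀ e → G (suc m) (norm e) ≡ boolℤ (sameMono [] e) +ℤ (along single e +ℤ along pair e)
    recurrence e = trans (inverse-recurrence G inverse (suc m) (s≤s z≤n) e)
                         (ℤ.+-assoc (boolℤ (sameMono [] e)) (along single e) (along pair e))

    along-degree0 : ∀ ℓ e → exponent 0 e ≤ 0 → along ℓ e ≡ 0ℤ
    along-degree0 ℓ e e≤0 with letterWeight (suc m) ℓ ∣ᵐ e in ℓ∣e
    ... | false = refl
    ... | true with () ← ≤-trans (≤-trans (1≤exponent₀-letterWeight m ℓ) (∣ᵐ⇒≤ _ e ℓ∣e 0)) e≤0

  inverse-enumerates-words : ∀ K → Enumerates K (G (suc m)) (wordsUpTo K) (wordWeight (suc m))
  inverse-enumerates-words zero = enumerates λ e e≤0 → let open ≡-Reasoning in begin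
    G (suc m) (norm e)                                                    ≡⟨ recurrence e ⟩
    boolℤ (sameMono [] e) +ℤ (along single e +ℤ along pair e)
      ≡⟨ cong₂ (λ x y → boolℤ (sameMono [] e) +ℤ (x +ℤ y)) (along-degree0 single e e≤0) (along-degree0 pair e e≤0) ⟩
    boolℤ (sameMono [] e) +ℤ 0ℤ                                           ≡⟨ +countᵇ-∷ (hasWeight e) [] [] ⟨
    + countᵇ (hasWeight e) (wordsUpTo zero)                                  ∎
  inverse-enumerates-words (suc K) = enumerates coefficient-words
    where
    coefficient-words : ∀ e → exponent 0 e ≤ suc K →
      G (suc m) (norm e) ≡ + countᵇ (λ w → sameMono (wordWeight (suc m) w) e) (wordsUpTo (suc K))
    coefficient-words e e≤1+K = begin
      G (suc m) (norm e)                                                    ≡⟨ recurrence e ⟩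
      boolℤ (sameMono [] e) +ℤ (along single e +ℤ along pair e)
        ≡⟨ cong (boolℤ (sameMono [] e) +ℤ_) (cong₂ _+ℤ_ (along-count single) (along-count pair)) ⟩
      boolℤ (sameMono [] e) +ℤ (+ countᵇ (hasWeight e) singles +ℤ + countᵇ (hasWeight e) pairs)
        ≡⟨ cong (λ x → boolℤ (sameMono [] e) +ℤ + x) (countᵇ-++ (hasWeight e) singles pairs) ⟨
      boolℤ (sameMono [] e) +ℤ + countᵇ (hasWeight e) (singles ++ pairs)
        ≡⟨ +countᵇ-∷ (hasWeight e) [] (singles ++ pairs) ⟨
      + countᵇ (hasWeight e) (wordsUpTo (suc K))                               ∎
      where
      open ≡-Reasoning
      singles pairs : List Word
      singles = map (single ∷_) (wordsUpTo K)
      pairs   = map (pair ∷_) (wordsUpTo K)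
      along-count : ∀ ℓ → along ℓ e ≡ + countᵇ (hasWeight e) (map (ℓ ∷_) (wordsUpTo K))
      along-count ℓ rewrite countᵇ-map (hasWeight e) (ℓ ∷_) (wordsUpTo K)
                          | countᵇ-sameMono-*ᵐ (letterWeight (suc m) ℓ) (wordWeight (suc m)) e (wordsUpTo K)
                     with letterWeight (suc m) ℓ ∣ᵐ e in ℓ∣e
      ... | false = refl
      ... | true  = coefficient (inverse-enumerates-words K) (e /ᵐ letterWeight (suc m) ℓ)
                      (subst (_≤ K) (sym (exponent-/ᵐ 0 e _))
                        (≤-trans (∸-monoʳ-≤ (exponent 0 e) (1≤exponent₀-letterWeight m ℓ)) (∸-monoˡ-≤ 1 e≤1+K)))

tupleWeight : ℕ → List Word → Mono
tupleWeight k []       = []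
tupleWeight k (w ∷ ws) = wordWeight k w *ᵐ tupleWeight (suc k) ws

weight : List Word → Mono
weight ws = numExp (length ws) *ᵐ tupleWeight 1 ws

snoc : List Word × Word → List Word
snoc (ws , w) = ws ++ w ∷ []

tuples : ℕ → ℕ → List (List Word)
tuples K zero    = [] ∷ []
tuples K (suc n) = map snoc (cartesianProduct (tuples K n) (wordsUpTo K))

length-snoc : ∀ {A : Set} (xs : List A) x → length (xs ++ x ∷ []) ≡ suc (length xs)
length-snoc xs x = trans (length-++ xs) (+-comm (length xs) 1)

length-∈tuples : ∀ K n {ws} → ws ∈ tuples K n → length ws ≡ n
length-∈tuples K zero    (here refl) = refl
length-∈tuples K (suc n) m with ∈-map⁻ snoc m
... | (ws , w) , ws,w∈ , refl =
  trans (length-snoc ws w) (cong suc (length-∈tuples K n (proj₁ (∈-cartesianProduct⁻ (tuples K n) (wordsUpTo K) ws,w∈))))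

tupleWeight-snoc : ∀ k ws w → tupleWeight k ws *ᵐ wordWeight (k + length ws) w ≋ tupleWeight k (ws ++ w ∷ [])
tupleWeight-snoc k []       w = pointwise λ i → begin
  exponent i ([] *ᵐ wordWeight (k + 0) w)       ≡⟨ cong (λ j → exponent i (wordWeight j w)) (+-identityʳ k) ⟩
  exponent i (wordWeight k w)                   ≡⟨ +-identityʳ _ ⟨
  exponent i (wordWeight k w) + 0               ≡⟨ exponent-*ᵐ i (wordWeight k w) [] ⟨
  exponent i (wordWeight k w *ᵐ [])             ∎
  where open ≡-Reasoning
tupleWeight-snoc k (v ∷ ws) w = pointwise λ i → begin
  exponent i ((wordWeight k v *ᵐ tupleWeight (suc k) ws) *ᵐ wordWeight (k + suc (length ws)) w)
    ≡⟨ exponent-*ᵐ i (wordWeight k v *ᵐ tupleWeight (suc k) ws) _ ⟩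
  exponent i (wordWeight k v *ᵐ tupleWeight (suc k) ws) + exponent i (wordWeight (k + suc (length ws)) w)
    ≡⟨ cong₂ _+_ (exponent-*ᵐ i (wordWeight k v) _) (cong (λ j → exponent i (wordWeight j w)) (+-suc k (length ws))) ⟩
  exponent i (wordWeight k v) + exponent i (tupleWeight (suc k) ws) + exponent i (wordWeight (suc k + length ws) w)
    ≡⟨ +-assoc (exponent i (wordWeight k v)) _ _ ⟩
  exponent i (wordWeight k v) + (exponent i (tupleWeight (suc k) ws) + exponent i (wordWeight (suc k + length ws) w))
    ≡⟨ cong (_+_ (exponent i (wordWeight k v)))
            (trans (sym (exponent-*ᵐ i (tupleWeight (suc k) ws) _)) (at (tupleWeight-snoc (suc k) ws w) i)) ⟩
  exponent i (wordWeight k v) + exponent i (tupleWeight (suc k) (ws ++ w ∷ []))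
    ≡⟨ exponent-*ᵐ i (wordWeight k v) _ ⟨
  exponent i (tupleWeight k (v ∷ ws ++ w ∷ [])) ∎
  where open ≡-Reasoning

module _ (G : ℕ → FPS) (inverse : AreInverses G) where

  product-enumerates-tuples : ∀ K n → Enumerates K (prodFrom1 G n) (tuples K n) (tupleWeight 1)
  product-enumerates-tuples K zero =
    Enumerates-map (λ _ → []) (tupleWeight 1) (Enumerates-mono []) λ _ → ≋-refl
  product-enumerates-tuples K (suc n) =
    Enumerates-map snoc (tupleWeight 1)
      (Enumerates-⊛ (product-enumerates-tuples K n) (inverse-enumerates-words G inverse n K))
      λ {(ws , w)} ws,w∈ → subst (λ j → tupleWeight 1 ws *ᵐ wordWeight (suc j) w ≋ tupleWeight 1 (ws ++ w ∷ []))
                             (length-∈tuples K n (proj₁ (∈-cartesianProduct⁻ (tuples K n) (wordsUpTo K) ws,w∈)))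
                             (tupleWeight-snoc 1 ws w)

  rhsTerm-enumerates-tuples : ∀ K n → Enumerates K (rhsTerm G n) (tuples K n) weight
  rhsTerm-enumerates-tuples K zero = Enumerates-map (λ _ → []) weight (Enumerates-mono []) λ _ → ≋-refl
  rhsTerm-enumerates-tuples K (suc n) =
    subst (λ X → Enumerates K (rhsTerm G (suc n)) X weight) (map-proj₂ (tuples K (suc n)))
      (Enumerates-map proj₂ weight (Enumerates-⊛ (Enumerates-mono (numExp (suc n))) (product-enumerates-tuples K (suc n)))
        λ {(_ , ws)} ∈X → subst (λ j → numExp (suc n) *ᵐ tupleWeight 1 ws ≋ numExp j *ᵐ tupleWeight 1 ws)
                             (sym (length-∈tuples K (suc n) (proj₂ (∈-cartesianProduct⁻ (tt ∷ []) (tuples K (suc n)) ∈X))))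
                             ≋-refl)
    where
    map-proj₂ : ∀ {A : Set} (ys : List A) → map proj₂ (cartesianProduct (tt ∷ []) ys) ≡ ys
    map-proj₂ ys = trans (cong (map proj₂) (++-identityʳ (map (tt ,_) ys))) (trans (sym (map-∘ ys)) (map-id ys))

-- increasing subsequences of length d with all entries above b
incAbove : ℕ → ℕ → List ℕ → ℕ
incAbove zero    b xs       = 1
incAbove (suc d) b []       = 0
incAbove (suc d) b (x ∷ xs) = incAbove (suc d) b xs + (if b <ᵇ x then incAbove d x xs else 0)

inc : ℕ → List ℕ → ℕ
inc zero    xs       = 1
inc (suc d) []       = 0
inc (suc d) (x ∷ xs) = inc (suc d) xs + incAbove d x xs

countᵇ-subseqs-incAbove : ∀ d b xs →
  countᵇ (λ τ → (length τ ≡ᵇ d) ∧ increasing (b ∷ τ)) (subseqs xs) ≡ incAbove d b xs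
countᵇ-subseqs-incAbove zero    b []       = refl
countᵇ-subseqs-incAbove (suc d) b []       = refl
countᵇ-subseqs-incAbove d       b (x ∷ xs) =
  trans (countᵇ-++ _ (subseqs xs) _)
        (cong₂ _+_ (countᵇ-subseqs-incAbove d b xs) (countᵇ-map _ (x ∷_) (subseqs xs)) ⟨ trans ⟩ headed d)
  where
  headed : ∀ d → incAbove d b xs + countᵇ (λ τ → (length (x ∷ τ) ≡ᵇ d) ∧ increasing (b ∷ x ∷ τ)) (subseqs xs)
               ≡ incAbove d b (x ∷ xs)
  headed zero    = cong suc (countᵇ-none _ (subseqs xs) λ _ → refl)
  headed (suc d) with b <ᵇ x
  ... | true  = cong (_+_ (incAbove (suc d) b xs)) (countᵇ-subseqs-incAbove d x xs)
  ... | false = cong (_+_ (incAbove (suc d) b xs)) (countᵇ-none _ (subseqs xs) λ {τ} _ → ∧-zeroʳ (length τ ≡ᵇ d))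

incCount≡inc : ∀ d xs → incCount d xs ≡ inc d xs
incCount≡inc d xs = trans (length-filter _ (subseqs xs)) (counted d xs)
  where
  counted : ∀ d xs → countᵇ (λ τ → (length τ ≡ᵇ d) ∧ increasing τ) (subseqs xs) ≡ inc d xs
  counted zero    []       = refl
  counted (suc d) []       = refl
  counted d       (x ∷ xs) =
    trans (countᵇ-++ _ (subseqs xs) _)
          (cong₂ _+_ (counted d xs) (countᵇ-map _ (x ∷_) (subseqs xs)) ⟨ trans ⟩ headed d)
    where
    headed : ∀ d → inc d xs + countᵇ (λ τ → (length (x ∷ τ) ≡ᵇ d) ∧ increasing (x ∷ τ)) (subseqs xs)
                 ≡ inc d (x ∷ xs)
    headed zero    = cong suc (countᵇ-none _ (subseqs xs) λ _ → refl)
    headed (suc d) = cong (_+_ (inc (suc d) xs)) (countᵇ-subseqs-incAbove d x xs)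

infix 4 _≻_

_≻_ : List ℕ → List ℕ → Set
xs ≻ ys = All (λ x → All (_< x) ys) xs

incAbove-vanishes : ∀ d b ys → All (_≤ b) ys → incAbove (suc d) b ys ≡ 0
incAbove-vanishes d b []       _            = refl
incAbove-vanishes d b (y ∷ ys) (y≤b ∷ ys≤b)
  rewrite incAbove-vanishes d b ys ys≤b | ≮⇒<ᵇ-false (≤⇒≯ y≤b) = refl

incAbove-skew : ∀ d b xs ys → xs ≻ ys → incAbove (suc d) b (xs ++ ys) ≡ incAbove (suc d) b xs + incAbove (suc d) b ys
incAbove-++-below : ∀ d x xs ys → xs ≻ ys → All (_< x) ys → incAbove d x (xs ++ ys) ≡ incAbove d x xs

incAbove-skew d b []       ys _ = refl
incAbove-skew d b (x ∷ xs) ys (x≻ys ∷ xs≻ys)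
  rewrite incAbove-skew d b xs ys xs≻ys with b <ᵇ x
... | false = xy∙z≈xz∙y (incAbove (suc d) b xs) (incAbove (suc d) b ys) 0
... | true rewrite incAbove-++-below d x xs ys xs≻ys x≻ys =
  xy∙z≈xz∙y (incAbove (suc d) b xs) (incAbove (suc d) b ys) (incAbove d x xs)

incAbove-++-below zero    x xs ys _     _    = refl
incAbove-++-below (suc d) x xs ys xs≻ys ys<x =
  trans (incAbove-skew d x xs ys xs≻ys)
        (trans (cong (_+_ (incAbove (suc d) x xs)) (incAbove-vanishes d x ys (All.map <⇒≤ ys<x))) (+-identityʳ _))

inc-skew : ∀ d xs ys → xs ≻ ys → inc (suc d) (xs ++ ys) ≡ inc (suc d) xs + inc (suc d) ys
inc-skew d []       ys _ = refl
inc-skew d (x ∷ xs) ys (x≻ys ∷ xs≻ys)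
  rewrite inc-skew d xs ys xs≻ys | incAbove-++-below d x xs ys xs≻ys x≻ys =
  xy∙z≈xz∙y (inc (suc d) xs) (inc (suc d) ys) (incAbove d x xs)

incAbove-appendMax : ∀ d b xs v → All (_< v) xs → b < v →
  incAbove (suc d) b (xs ++ v ∷ []) ≡ incAbove (suc d) b xs + incAbove d b xs
incAbove-appendMax zero    b []       v _ b<v rewrite <⇒<ᵇ-true b<v = refl
incAbove-appendMax (suc d) b []       v _ b<v rewrite <⇒<ᵇ-true b<v = refl
incAbove-appendMax zero    b (x ∷ xs) v (_ ∷ xs<v) b<v
  rewrite incAbove-appendMax zero b xs v xs<v b<v with b <ᵇ x
... | false = trans (+-identityʳ _) (cong (_+ 1) (sym (+-identityʳ _)))
... | true  = +-assoc (incAbove 1 b xs) 1 1 ⟨ trans ⟩ sym (+-assoc (incAbove 1 b xs) 1 1)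
incAbove-appendMax (suc d) b (x ∷ xs) v (x<v ∷ xs<v) b<v
  rewrite incAbove-appendMax (suc d) b xs v xs<v b<v with b <ᵇ x
... | false = interchange (incAbove (suc (suc d)) b xs) (incAbove (suc d) b xs) 0 0
... | true rewrite incAbove-appendMax d x xs v xs<v x<v =
  interchange (incAbove (suc (suc d)) b xs) (incAbove (suc d) b xs) (incAbove (suc d) x xs) (incAbove d x xs)

inc-appendMax : ∀ d xs v → All (_< v) xs → inc (suc d) (xs ++ v ∷ []) ≡ inc (suc d) xs + inc d xs
inc-appendMax zero    []       v _ = refl
inc-appendMax (suc d) []       v _ = refl
inc-appendMax zero    (x ∷ xs) v (_ ∷ xs<v)
  rewrite inc-appendMax zero xs v xs<v = +-assoc (inc 1 xs) 1 1 ⟨ trans ⟩ sym (+-assoc (inc 1 xs) 1 1)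
inc-appendMax (suc d) (x ∷ xs) v (x<v ∷ xs<v)
  rewrite inc-appendMax (suc d) xs v xs<v | incAbove-appendMax d x xs v xs<v x<v =
  interchange (inc (suc (suc d)) xs) (inc (suc d) xs) (incAbove (suc d) x xs) (incAbove d x xs)

inc-1 : ∀ xs → inc 1 xs ≡ length xs
inc-1 []       = refl
inc-1 (x ∷ xs) = trans (+-comm (inc 1 xs) 1) (cong suc (inc-1 xs))

incAbove-long : ∀ d b xs → length xs < d → incAbove d b xs ≡ 0
incAbove-long (suc d) b []       _ = refl
incAbove-long (suc d) b (x ∷ xs) (s≤s |xs|<d)
  rewrite incAbove-long (suc d) b xs (m<n⇒m<1+n |xs|<d) with b <ᵇ x
... | true  = incAbove-long d x xs |xs|<d
... | false = refl

inc-long : ∀ d xs → length xs < d → inc d xs ≡ 0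
inc-long (suc d) []       _ = refl
inc-long (suc d) (x ∷ xs) (s≤s |xs|<d)
  rewrite inc-long (suc d) xs (m<n⇒m<1+n |xs|<d) = incAbove-long d x xs |xs|<d

exponent-map-applyUpTo : ∀ (f g : ℕ → ℕ) n → (∀ i → n ≤ i → f (g i) ≡ 0) →
  ∀ i → exponent i (map f (applyUpTo g n)) ≡ f (g i)
exponent-map-applyUpTo f g zero    beyond i       = sym (beyond i z≤n)
exponent-map-applyUpTo f g (suc n) beyond zero    = refl
exponent-map-applyUpTo f g (suc n) beyond (suc i) =
  exponent-map-applyUpTo f (g ∘ suc) n (λ i n≤i → beyond (suc i) (s≤s n≤i)) i

exponent-monoOf : ∀ π i → exponent i (monoOf π) ≡ inc (suc i) π
exponent-monoOf π i = trans
  (exponent-map-applyUpTo (λ d → incCount d π) suc (length π)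
    (λ i |π|≤i → trans (incCount≡inc (suc i) π) (inc-long (suc i) π (s≤s |π|≤i))) i)
  (incCount≡inc (suc i) π)

-- Pascal's rule on exponent vectors: the substitution x_j ↦ x_j x_{j+1}

pascal : Mono → Mono
pascal v = v *ᵐ (0 ∷ v)

x₁ : Mono
x₁ = 1 ∷ []

≋-pascal : ∀ {u} v → exponent 0 u ≡ exponent 0 v → (∀ i → exponent (suc i) u ≡ exponent (suc i) v + exponent i v) →
  u ≋ pascal v
≋-pascal {u} v u₀ u₊ = pointwise λ where
  zero    → trans u₀ (sym (exponent-*ᵐ 0 v (0 ∷ v) ⟨ trans ⟩ +-identityʳ _))
  (suc i) → trans (u₊ i) (sym (exponent-*ᵐ (suc i) v (0 ∷ v)))

≋-x₁*ᵐpascal : ∀ {u} v → exponent 0 u ≡ suc (exponent 0 v) →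
  (∀ i → exponent (suc i) u ≡ exponent (suc i) v + exponent i v) → u ≋ x₁ *ᵐ pascal v
≋-x₁*ᵐpascal {u} v u₀ u₊ = pointwise λ where
  zero    → trans u₀ (cong suc (sym (exponent-*ᵐ 0 v (0 ∷ v) ⟨ trans ⟩ +-identityʳ _)))
  (suc i) → trans (u₊ i) (sym (exponent-*ᵐ (suc i) v (0 ∷ v)) ⟨ trans ⟩ exponent-suc i (pascal v))

pascal-cong : ∀ {u v} → u ≋ v → pascal u ≋ pascal v
pascal-cong {u} {v} p = *ᵐ-cong p (pointwise λ where
  zero    → refl
  (suc i) → at p i)

pascal-*ᵐ : ∀ u v → pascal (u *ᵐ v) ≋ pascal u *ᵐ pascal v
pascal-*ᵐ u v = pointwise λ i → begin
  exponent i (pascal (u *ᵐ v))                          ≡⟨ exponent-*ᵐ i (u *ᵐ v) _ ⟩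
  exponent i (u *ᵐ v) + exponent i (0 ∷ u *ᵐ v)         ≡⟨ cong₂ _+_ (exponent-*ᵐ i u v) (shifted i) ⟩
  (exponent i u + exponent i v) + (exponent i (0 ∷ u) + exponent i (0 ∷ v)) ≡⟨ interchange (exponent i u) _ _ _ ⟩
  (exponent i u + exponent i (0 ∷ u)) + (exponent i v + exponent i (0 ∷ v))
    ≡⟨ cong₂ _+_ (exponent-*ᵐ i u _) (exponent-*ᵐ i v _) ⟨
  exponent i (pascal u) + exponent i (pascal v)         ≡⟨ exponent-*ᵐ i (pascal u) (pascal v) ⟨
  exponent i (pascal u *ᵐ pascal v)                     ∎
  where
  open ≡-Reasoning
  shifted : ∀ i → exponent i (0 ∷ u *ᵐ v) ≡ exponent i (0 ∷ u) + exponent i (0 ∷ v)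
  shifted zero    = refl
  shifted (suc i) = exponent-*ᵐ i u v

exponent-numExp : ∀ n i → exponent i (numExp n) ≡ n C suc i
exponent-numExp n = exponent-map-applyUpTo (n C_) suc n λ i n≤i → k>n⇒nCk≡0 (s≤s n≤i)

exponent-aExp : ∀ k i → exponent i (aExp (suc k)) ≡ k C i
exponent-aExp k = exponent-map-applyUpTo (k C_) id (suc k) λ i k<i → k>n⇒nCk≡0 k<i

exponent-bExp : ∀ k i → exponent i (bExp (suc k)) ≡ 2 * (k C i) + prevC (suc k) i
exponent-bExp k = exponent-map-applyUpTo (λ i → 2 * (k C i) + prevC (suc k) i) id (suc (suc k)) beyond
  where
  beyond : ∀ i → suc (suc k) ≤ i → 2 * (k C i) + prevC (suc k) i ≡ 0
  beyond (suc i) (s≤s k<i) rewrite k>n⇒nCk≡0 (m<n⇒m<1+n k<i) | k>n⇒nCk≡0 k<i = refl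

pascal-rule : ∀ n k → suc n C suc k ≡ n C suc k + n C k
pascal-rule n k = trans (sym (nCk+nC[k+1]≡[n+1]C[k+1] n k)) (+-comm (n C k) _)

numExp-suc : ∀ n → numExp (suc n) ≋ x₁ *ᵐ pascal (numExp n)
numExp-suc n = ≋-x₁*ᵐpascal (numExp n)
  (exponent-numExp (suc n) 0 ⟨ trans ⟩ pascal-rule n 0 ⟨ trans ⟩ +-comm (n C 1) 1 ⟨ trans ⟩
   cong suc (sym (exponent-numExp n 0)))
  λ i → trans (exponent-numExp (suc n) (suc i))
              (trans (pascal-rule n (suc i)) (sym (cong₂ _+_ (exponent-numExp n (suc i)) (exponent-numExp n i))))

aExp-suc : ∀ k → aExp (suc (suc k)) ≋ pascal (aExp (suc k))
aExp-suc k = ≋-pascal (aExp (suc k)) refl λ i →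
  trans (exponent-aExp (suc k) (suc i)) (trans (pascal-rule k i) (sym (cong₂ _+_ (exponent-aExp k (suc i)) (exponent-aExp k i))))

bExp-suc : ∀ k → bExp (suc (suc k)) ≋ pascal (bExp (suc k))
bExp-suc k = ≋-pascal (bExp (suc k)) refl λ i → trans (exponent-bExp (suc k) (suc i))
  (trans (rule i) (sym (cong₂ _+_ (exponent-bExp k (suc i)) (exponent-bExp k i))))
  where
  rule : ∀ i → 2 * (suc k C suc i) + suc k C i ≡ (2 * (k C suc i) + k C i) + (2 * (k C i) + prevC (suc k) i)
  rule zero    = trans (cong (λ c → 2 * c + 1) (pascal-rule k 0)) (regroup (k C 1))
    where
    regroup : ∀ a → 2 * (a + 1) + 1 ≡ (2 * a + 1) + (2 * 1 + 0)
    regroup = ℕ-solve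
  rule (suc i) = trans (cong₂ (λ c d → 2 * c + d) (pascal-rule k (suc i)) (pascal-rule k i))
                       (regroup (k C suc (suc i)) (k C suc i) (k C i))
    where
    regroup : ∀ a b c → 2 * (a + b) + (b + c) ≡ (2 * a + b) + (2 * b + c)
    regroup = ℕ-solve

letterWeight-suc : ∀ k ℓ → letterWeight (suc (suc k)) ℓ ≋ pascal (letterWeight (suc k) ℓ)
letterWeight-suc k single = aExp-suc k
letterWeight-suc k pair   = bExp-suc k

wordWeight-suc : ∀ k w → wordWeight (suc (suc k)) w ≋ pascal (wordWeight (suc k) w)
wordWeight-suc k []      = pointwise λ where
  zero    → refl
  (suc i) → sym (exponent-*ᵐ (suc i) [] (0 ∷ []))
wordWeight-suc k (ℓ ∷ w) = ≋-trans (*ᵐ-cong (letterWeight-suc k ℓ) (wordWeight-suc k w))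
                                   (≋-sym (pascal-*ᵐ (letterWeight (suc k) ℓ) (wordWeight (suc k) w)))

tupleWeight-suc : ∀ k ws → tupleWeight (suc (suc k)) ws ≋ pascal (tupleWeight (suc k) ws)
tupleWeight-suc k []       = wordWeight-suc k []
tupleWeight-suc k (w ∷ ws) = ≋-trans (*ᵐ-cong (wordWeight-suc k w) (tupleWeight-suc (suc k) ws))
                                     (≋-sym (pascal-*ᵐ (wordWeight (suc k) w) (tupleWeight (suc (suc k)) ws)))

weight-∷ : ∀ w ws → weight (w ∷ ws) ≋ wordWeight 1 w *ᵐ (x₁ *ᵐ pascal (weight ws))
weight-∷ w ws = pointwise λ i → begin
  exponent i (numExp (suc n) *ᵐ (wordWeight 1 w *ᵐ tupleWeight 2 ws))
    ≡⟨ exponent-*ᵐ i (numExp (suc n)) (wordWeight 1 w *ᵐ tupleWeight 2 ws) ⟨ trans ⟩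
       cong (_+_ (exponent i (numExp (suc n)))) (exponent-*ᵐ i (wordWeight 1 w) (tupleWeight 2 ws)) ⟩
  exponent i (numExp (suc n)) + (exponent i (wordWeight 1 w) + exponent i (tupleWeight 2 ws))
    ≡⟨ cong₂ (λ a c → a + (exponent i (wordWeight 1 w) + c)) (at (numExp-suc n) i) (at (tupleWeight-suc 0 ws) i) ⟩
  exponent i (x₁ *ᵐ pascal (numExp n)) + (exponent i (wordWeight 1 w) + exponent i (pascal (tupleWeight 1 ws)))
    ≡⟨ regroup i ⟩
  exponent i (wordWeight 1 w) + exponent i (x₁ *ᵐ (pascal (numExp n) *ᵐ pascal (tupleWeight 1 ws)))
    ≡⟨ cong (_+_ (exponent i (wordWeight 1 w)))
            (at (*ᵐ-cong (≋-refl {x₁}) (≋-sym (pascal-*ᵐ (numExp n) (tupleWeight 1 ws)))) i) ⟩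
  exponent i (wordWeight 1 w) + exponent i (x₁ *ᵐ pascal (weight ws))
    ≡⟨ exponent-*ᵐ i (wordWeight 1 w) _ ⟨
  exponent i (wordWeight 1 w *ᵐ (x₁ *ᵐ pascal (weight ws))) ∎
  where
  open ≡-Reasoning
  n : ℕ
  n = length ws
  regroup : ∀ i → exponent i (x₁ *ᵐ pascal (numExp n)) + (exponent i (wordWeight 1 w) + exponent i (pascal (tupleWeight 1 ws)))
                ≡ exponent i (wordWeight 1 w) + exponent i (x₁ *ᵐ (pascal (numExp n) *ᵐ pascal (tupleWeight 1 ws)))
  regroup i rewrite exponent-*ᵐ i x₁ (pascal (numExp n)) | exponent-*ᵐ i x₁ (pascal (numExp n) *ᵐ pascal (tupleWeight 1 ws))
                  | exponent-*ᵐ i (pascal (numExp n)) (pascal (tupleWeight 1 ws)) =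
    shuffle (exponent i x₁) (exponent i (pascal (numExp n))) (exponent i (wordWeight 1 w)) (exponent i (pascal (tupleWeight 1 ws)))
    where
    shuffle : ∀ a b c d → (a + b) + (c + d) ≡ c + (a + (b + d))
    shuffle = ℕ-solve

monoOf-skew : ∀ xs ys → xs ≻ ys → monoOf (xs ++ ys) ≋ monoOf xs *ᵐ monoOf ys
monoOf-skew xs ys xs≻ys = pointwise λ i →
  exponent-monoOf (xs ++ ys) i ⟨ trans ⟩ inc-skew i xs ys xs≻ys ⟨ trans ⟩
  sym (exponent-*ᵐ i (monoOf xs) (monoOf ys) ⟨ trans ⟩ cong₂ _+_ (exponent-monoOf xs i) (exponent-monoOf ys i))

monoOf-appendMax : ∀ xs v → All (_< v) xs → monoOf (xs ++ v ∷ []) ≋ x₁ *ᵐ pascal (monoOf xs)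
monoOf-appendMax xs v xs<v = ≋-x₁*ᵐpascal (monoOf xs)
  (exponent-monoOf (xs ++ v ∷ []) 0 ⟨ trans ⟩ inc-appendMax 0 xs v xs<v ⟨ trans ⟩
   +-comm (inc 1 xs) 1 ⟨ trans ⟩ cong suc (sym (exponent-monoOf xs 0)))
  λ i → exponent-monoOf (xs ++ v ∷ []) (suc i) ⟨ trans ⟩ inc-appendMax (suc i) xs v xs<v ⟨ trans ⟩
        sym (cong₂ _+_ (exponent-monoOf xs (suc i)) (exponent-monoOf xs i))

block : Letter → ℕ → List ℕ
block single t = t ∷ []
block pair   t = t ∷ suc t ∷ []

blockSize : Letter → ℕ
blockSize single = 1
blockSize pair   = 2

entries : Word → ℕ
entries []      = 0
entries (ℓ ∷ w) = blockSize ℓ + entries w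

size : List Word → ℕ
size []       = 0
size (w ∷ ws) = suc (entries w + size ws)

-- the blocks of w, stacked downwards from entries w + base to base + 1
blocks : Word → ℕ → List ℕ
blocks []      base = []
blocks (ℓ ∷ w) base = block ℓ (suc (entries w + base)) ++ blocks w base

-- π = blocks ⊖ (π′ ⊕ 1): the first word is placed on top, the rest below the new maximum
toPerm : List Word → List ℕ
toPerm []       = []
toPerm (w ∷ ws) = blocks w (suc (size ws)) ++ toPerm ws ++ suc (size ws) ∷ []

length-blocks : ∀ w b → length (blocks w b) ≡ entries w
length-blocks []           b = refl
length-blocks (single ∷ w) b = cong suc (length-blocks w b)
length-blocks (pair ∷ w)   b = cong (suc ∘ suc) (length-blocks w b)

length-toPerm : ∀ ws → length (toPerm ws) ≡ size ws
length-toPerm []       = refl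
length-toPerm (w ∷ ws) = begin
  length (blocks w (suc (size ws)) ++ toPerm ws ++ suc (size ws) ∷ [])
    ≡⟨ length-++ (blocks w _) ⟩
  length (blocks w (suc (size ws))) + length (toPerm ws ++ suc (size ws) ∷ [])
    ≡⟨ cong₂ _+_ (length-blocks w _) (length-snoc (toPerm ws) _ ⟨ trans ⟩ cong suc (length-toPerm ws)) ⟩
  entries w + suc (size ws)
    ≡⟨ +-suc (entries w) (size ws) ⟩
  suc (entries w + size ws) ∎
  where open ≡-Reasoning

blocks-bounded : ∀ w b → All (λ x → b < x × x ≤ entries w + b) (blocks w b)
blocks-bounded []           b = []
blocks-bounded (single ∷ w) b =
  (s≤s (m≤n+m b (entries w)) , ≤-refl) ∷ All.map (Product.map₂ m≤n⇒m≤1+n) (blocks-bounded w b)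
blocks-bounded (pair ∷ w)   b =
  (s≤s (m≤n+m b (entries w)) , n≤1+n _) ∷ (m<n⇒m<1+n (s≤s (m≤n+m b (entries w))) , ≤-refl)
  ∷ All.map (Product.map₂ (m≤n⇒m≤1+n ∘ m≤n⇒m≤1+n)) (blocks-bounded w b)

toPerm-bounded : ∀ ws → All (λ x → 1 ≤ x × x ≤ size ws) (toPerm ws)
toPerm-bounded []       = []
toPerm-bounded (w ∷ ws) = All.++⁺
  (All.map (λ {x} (b<x , x≤) → ≤-trans (s≤s z≤n) b<x , subst (x ≤_) (+-suc (entries w) (size ws)) x≤)
           (blocks-bounded w (suc (size ws))))
  (All.++⁺ (All.map (Product.map₂ (λ x≤ → ≤-trans x≤ (≤-trans (m≤n+m (size ws) (entries w)) (n≤1+n _))))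
                    (toPerm-bounded ws))
           ((s≤s z≤n , s≤s (m≤n+m (size ws) (entries w))) ∷ []))

monoOf-block : ∀ ℓ t → monoOf (block ℓ t) ≋ letterWeight 1 ℓ
monoOf-block single t = pointwise λ where
  zero    → refl
  (suc i) → refl
monoOf-block pair t = pointwise λ where
  zero          → refl
  (suc zero)    → trans (exponent-monoOf (t ∷ suc t ∷ []) 1) (cong (if_then 1 else 0) (<⇒<ᵇ-true (n<1+n t)))
  (suc (suc i)) → refl

blocks-≻ : ∀ ℓ w b → block ℓ (suc (entries w + b)) ≻ blocks w b
blocks-≻ single w b = All.map (λ (_ , x≤) → s≤s x≤) (blocks-bounded w b) ∷ []
blocks-≻ pair   w b = All.map (λ (_ , x≤) → s≤s x≤) (blocks-bounded w b)
                    ∷ All.map (λ (_ , x≤) → s≤s (m≤n⇒m≤1+n x≤)) (blocks-bounded w b) ∷ []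

monoOf-blocks : ∀ w b → monoOf (blocks w b) ≋ wordWeight 1 w
monoOf-blocks []      b = ≋-refl
monoOf-blocks (ℓ ∷ w) b = ≋-trans (monoOf-skew (block ℓ _) (blocks w b) (blocks-≻ ℓ w b))
                                  (*ᵐ-cong (monoOf-block ℓ _) (monoOf-blocks w b))

monoOf-toPerm : ∀ ws → monoOf (toPerm ws) ≋ weight ws
monoOf-toPerm []       = ≋-refl
monoOf-toPerm (w ∷ ws) = begin
  monoOf (blocks w base ++ toPerm ws ++ base ∷ [])
    ≈⟨ monoOf-skew (blocks w base) _ blocks≻rest ⟩
  monoOf (blocks w base) *ᵐ monoOf (toPerm ws ++ base ∷ [])
    ≈⟨ *ᵐ-cong (monoOf-blocks w base) (monoOf-appendMax (toPerm ws) base below) ⟩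
  wordWeight 1 w *ᵐ (x₁ *ᵐ pascal (monoOf (toPerm ws)))
    ≈⟨ *ᵐ-cong (≋-refl {wordWeight 1 w}) (*ᵐ-cong (≋-refl {x₁}) (pascal-cong (monoOf-toPerm ws))) ⟩
  wordWeight 1 w *ᵐ (x₁ *ᵐ pascal (weight ws))
    ≈⟨ weight-∷ w ws ⟨
  weight (w ∷ ws) ∎
  where
  open SetoidReasoning ≋-setoid
  base : ℕ
  base = suc (size ws)
  below : All (_< base) (toPerm ws)
  below = All.map (s≤s ∘ proj₂) (toPerm-bounded ws)
  blocks≻rest : blocks w base ≻ toPerm ws ++ base ∷ []
  blocks≻rest = All.map (λ (base<x , _) → All.++⁺ (All.map (λ y<base → <-trans y<base base<x) below) (base<x ∷ []))
                        (blocks-bounded w base)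

∈subseqs⇒⊆ : ∀ π {τ} → τ ∈ subseqs π → τ ⊆ π
∈subseqs⇒⊆ []       (here refl) = []
∈subseqs⇒⊆ (x ∷ xs) m with ∈-++⁻ (subseqs xs) m
... | inj₁ m₁ = x ∷ʳ ∈subseqs⇒⊆ xs m₁
... | inj₂ m₂ with ∈-map⁻ (x ∷_) m₂
...   | τ , m₃ , refl = refl ∷ ∈subseqs⇒⊆ xs m₃

⊆⇒∈subseqs : ∀ {τ π} → τ ⊆ π → τ ∈ subseqs π
⊆⇒∈subseqs []                     = here refl
⊆⇒∈subseqs (y ∷ʳ p)               = ∈-++⁺ˡ (⊆⇒∈subseqs p)
⊆⇒∈subseqs {π = x ∷ xs} (refl ∷ p) = ∈-++⁺ʳ (subseqs xs) (∈-map⁺ (x ∷_) (⊆⇒∈subseqs p))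

p132 p2341 p3241 : List ℕ
p132  = 1 ∷ 3 ∷ 2 ∷ []
p2341 = 2 ∷ 3 ∷ 4 ∷ 1 ∷ []
p3241 = 3 ∷ 2 ∷ 4 ∷ 1 ∷ []

-- the comparisons that sameOrder performs against 132, 2341 and 3241
Pattern132 : ℕ → ℕ → ℕ → Set
Pattern132 a b c = a < b × a < c × c ≤ b

Pattern2341 : ℕ → ℕ → ℕ → ℕ → Set
Pattern2341 a b c d = a < b × a < c × d ≤ a × b < c × d ≤ b × d ≤ c

Pattern3241 : ℕ → ℕ → ℕ → ℕ → Set
Pattern3241 a b c d = b ≤ a × a < c × d ≤ a × b < c × d ≤ b × d ≤ c

record Avoids (π : List ℕ) : Set where
  field
    no132  : ∀ {a b c}   → a ∷ b ∷ c ∷ []     ⊆ π → ¬ Pattern132 a b c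
    no2341 : ∀ {a b c d : ℕ} → a ∷ b ∷ c ∷ d ∷ [] ⊆ π → ¬ Pattern2341 a b c d
    no3241 : ∀ {a b c d : ℕ} → a ∷ b ∷ c ∷ d ∷ [] ⊆ π → ¬ Pattern3241 a b c d
open Avoids

Avoids-⊆ : ∀ {π′ π} → π′ ⊆ π → Avoids π → Avoids π′
Avoids-⊆ π′⊆π av = record
  { no132  = no132 av  ∘ (λ p → ⊆-trans p π′⊆π)
  ; no2341 = no2341 av ∘ (λ p → ⊆-trans p π′⊆π)
  ; no3241 = no3241 av ∘ (λ p → ⊆-trans p π′⊆π) }

private
  ≮ᵇ⇒≥ : ∀ {m n} → (m <ᵇ n) ≡ false → n ≤ m
  ≮ᵇ⇒≥ {m} {n} eq = ≮⇒≥ λ m<n → case trans (sym (<⇒<ᵇ-true m<n)) eq of λ ()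

  agrees-< : ∀ {m n} → eqBool (m <ᵇ n) true ≡ true → m < n
  agrees-< {m} {n} h with m <ᵇ n in eq
  ... | true = <ᵇ-true⇒< eq

  agrees-≥ : ∀ {m n} → eqBool (m <ᵇ n) false ≡ true → n ≤ m
  agrees-≥ {m} {n} h with m <ᵇ n in eq
  ... | false = ≮ᵇ⇒≥ eq

sameOrder⇒Pattern132 : ∀ a b c → sameOrder (a ∷ b ∷ c ∷ []) p132 ≡ true → Pattern132 a b c
sameOrder⇒Pattern132 a b c h =
  let (a⋯ , b⋯) = ∧-true⁻ h ; (ab , a⋯) = ∧-true⁻ a⋯ ; (ac , _) = ∧-true⁻ a⋯
      (b⋯ , _) = ∧-true⁻ b⋯ ; (bc , _) = ∧-true⁻ b⋯
  in agrees-< ab , agrees-< ac , agrees-≥ bc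

sameOrder⇒Pattern2341 : ∀ a b c d → sameOrder (a ∷ b ∷ c ∷ d ∷ []) p2341 ≡ true → Pattern2341 a b c d
sameOrder⇒Pattern2341 a b c d h =
  let (a⋯ , b⋯) = ∧-true⁻ h ; (ab , a⋯) = ∧-true⁻ a⋯ ; (ac , a⋯) = ∧-true⁻ a⋯ ; (ad , _) = ∧-true⁻ a⋯
      (b⋯ , c⋯) = ∧-true⁻ b⋯ ; (bc , b⋯) = ∧-true⁻ b⋯ ; (bd , _) = ∧-true⁻ b⋯
      (c⋯ , _) = ∧-true⁻ c⋯ ; (cd , _) = ∧-true⁻ c⋯
  in agrees-< ab , agrees-< ac , agrees-≥ ad , agrees-< bc , agrees-≥ bd , agrees-≥ cd

sameOrder⇒Pattern3241 : ∀ a b c d → sameOrder (a ∷ b ∷ c ∷ d ∷ []) p3241 ≡ true → Pattern3241 a b c d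
sameOrder⇒Pattern3241 a b c d h =
  let (a⋯ , b⋯) = ∧-true⁻ h ; (ab , a⋯) = ∧-true⁻ a⋯ ; (ac , a⋯) = ∧-true⁻ a⋯ ; (ad , _) = ∧-true⁻ a⋯
      (b⋯ , c⋯) = ∧-true⁻ b⋯ ; (bc , b⋯) = ∧-true⁻ b⋯ ; (bd , _) = ∧-true⁻ b⋯
      (c⋯ , _) = ∧-true⁻ c⋯ ; (cd , _) = ∧-true⁻ c⋯
  in agrees-≥ ab , agrees-< ac , agrees-≥ ad , agrees-< bc , agrees-≥ bd , agrees-≥ cd

Pattern132⇒sameOrder : ∀ a b c → Pattern132 a b c → sameOrder (a ∷ b ∷ c ∷ []) p132 ≡ true
Pattern132⇒sameOrder a b c (a<b , a<c , c≤b)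
  rewrite <⇒<ᵇ-true a<b | <⇒<ᵇ-true a<c | ≮⇒<ᵇ-false (≤⇒≯ c≤b) = refl

Pattern2341⇒sameOrder : ∀ a b c d → Pattern2341 a b c d → sameOrder (a ∷ b ∷ c ∷ d ∷ []) p2341 ≡ true
Pattern2341⇒sameOrder a b c d (a<b , a<c , d≤a , b<c , d≤b , d≤c)
  rewrite <⇒<ᵇ-true a<b | <⇒<ᵇ-true a<c | ≮⇒<ᵇ-false (≤⇒≯ d≤a) | <⇒<ᵇ-true b<c
        | ≮⇒<ᵇ-false (≤⇒≯ d≤b) | ≮⇒<ᵇ-false (≤⇒≯ d≤c) = refl

Pattern3241⇒sameOrder : ∀ a b c d → Pattern3241 a b c d → sameOrder (a ∷ b ∷ c ∷ d ∷ []) p3241 ≡ true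
Pattern3241⇒sameOrder a b c d (b≤a , a<c , d≤a , b<c , d≤b , d≤c)
  rewrite ≮⇒<ᵇ-false (≤⇒≯ b≤a) | <⇒<ᵇ-true a<c | ≮⇒<ᵇ-false (≤⇒≯ d≤a) | <⇒<ᵇ-true b<c
        | ≮⇒<ᵇ-false (≤⇒≯ d≤b) | ≮⇒<ᵇ-false (≤⇒≯ d≤c) = refl

Occurs : List ℕ → List ℕ → Bool
Occurs σ τ = (length τ ≡ᵇ length σ) ∧ sameOrder τ σ

contains⇒occurrence : ∀ π σ → contains π σ ≡ true → ∃ λ τ → τ ⊆ π × Occurs σ τ ≡ true
contains⇒occurrence π σ h with find (any⁻ (Occurs σ) (subseqs π) (Equivalence.from T-≡ h))
... | τ , τ∈ , occ = τ , ∈subseqs⇒⊆ π τ∈ , Equivalence.to T-≡ occ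

occurrence⇒contains : ∀ π σ {τ} → τ ⊆ π → Occurs σ τ ≡ true → contains π σ ≡ true
occurrence⇒contains π σ τ⊆π occ =
  Equivalence.to T-≡ (any⁺ (Occurs σ) (lose (⊆⇒∈subseqs τ⊆π) (Equivalence.from T-≡ occ)))

inP132⇒Avoids : ∀ π → inP132 π ≡ true → Avoids π
inP132⇒Avoids π h = record
  { no132  = λ {a} {b} {c} p pat → excluded h₁₃₂ (occurrence⇒contains π p132 p (Pattern132⇒sameOrder a b c pat))
  ; no2341 = λ {a} {b} {c} {d} p pat → excluded h₂₃₄₁ (occurrence⇒contains π p2341 p (Pattern2341⇒sameOrder a b c d pat))
  ; no3241 = λ {a} {b} {c} {d} p pat → excluded h₃₂₄₁ (occurrence⇒contains π p3241 p (Pattern3241⇒sameOrder a b c d pat)) }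
  where
  h₁₃₂ : not (contains π p132) ≡ true
  h₁₃₂ = proj₁ (∧-true⁻ h)
  h₂₃₄₁ : not (contains π p2341) ≡ true
  h₂₃₄₁ = proj₁ (∧-true⁻ (proj₂ (∧-true⁻ {not (contains π p132)} h)))
  h₃₂₄₁ : not (contains π p3241) ≡ true
  h₃₂₄₁ = proj₂ (∧-true⁻ (proj₂ (∧-true⁻ {not (contains π p132)} h)))
  excluded : ∀ {b} → not b ≡ true → b ≡ true → ⊥
  excluded {true} () _

Avoids⇒inP132 : ∀ π → Avoids π → inP132 π ≡ true
Avoids⇒inP132 π av = ∧-true⁺ (absent no132-occ) (∧-true⁺ (absent no2341-occ) (absent no3241-occ))
  where
  absent : ∀ {b} → (b ≡ true → ⊥) → not b ≡ true
  absent {true}  b≢true = ⊥-elim (b≢true refl)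
  absent {false} _      = refl
  no132-occ : contains π p132 ≡ true → ⊥
  no132-occ h with contains⇒occurrence π _ h
  ... | a ∷ b ∷ c ∷ [] , p , occ = no132 av p (sameOrder⇒Pattern132 a b c occ)
  no2341-occ : contains π p2341 ≡ true → ⊥
  no2341-occ h with contains⇒occurrence π _ h
  ... | a ∷ b ∷ c ∷ d ∷ [] , p , occ = no2341 av p (sameOrder⇒Pattern2341 a b c d occ)
  no3241-occ : contains π p3241 ≡ true → ⊥
  no3241-occ h with contains⇒occurrence π _ h
  ... | a ∷ b ∷ c ∷ d ∷ [] , p , occ = no3241 av p (sameOrder⇒Pattern3241 a b c d occ)

Avoids-[] : Avoids []
Avoids-[] = record { no132 = λ () ; no2341 = λ () ; no3241 = λ () }

Avoids-∷-max : ∀ {t L} → All (_< t) L → Avoids L → Avoids (t ∷ L)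
Avoids-∷-max {t} {L} L<t av = record { no132 = no-132 ; no2341 = no-2341 ; no3241 = no-3241 }
  where
  no-132 : ∀ {a b c : ℕ} → a ∷ b ∷ c ∷ [] ⊆ t ∷ L → ¬ Pattern132 a b c
  no-132 (_ ∷ʳ p)   pat             = no132 av p pat
  no-132 (refl ∷ p) (t<b , _) with All-resp-⊆ p L<t
  ... | b<t ∷ _ = <-asym t<b b<t
  no-2341 : ∀ {a b c d : ℕ} → a ∷ b ∷ c ∷ d ∷ [] ⊆ t ∷ L → ¬ Pattern2341 a b c d
  no-2341 (_ ∷ʳ p)   pat             = no2341 av p pat
  no-2341 (refl ∷ p) (t<b , _) with All-resp-⊆ p L<t
  ... | b<t ∷ _ = <-asym t<b b<t
  no-3241 : ∀ {a b c d : ℕ} → a ∷ b ∷ c ∷ d ∷ [] ⊆ t ∷ L → ¬ Pattern3241 a b c d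
  no-3241 (_ ∷ʳ p)   pat              = no3241 av p pat
  no-3241 (refl ∷ p) (_ , t<c , _) with All-resp-⊆ p L<t
  ... | _ ∷ c<t ∷ _ = <-asym t<c c<t

-- in each pattern the first entry is exceeded by the third
Avoids-∷-ascent : ∀ {t t′ L} → t < t′ → All (_< t) L → Avoids L → Avoids (t ∷ t′ ∷ L)
Avoids-∷-ascent {t} {t′} {L} t<t′ L<t av = record { no132 = no-132 ; no2341 = no-2341 ; no3241 = no-3241 }
  where
  av′ : Avoids (t′ ∷ L)
  av′ = Avoids-∷-max (All.map (λ x<t → <-trans x<t t<t′) L<t) av
  third<t : ∀ {b c : ℕ} {r} → b ∷ c ∷ r ⊆ t′ ∷ L → c < t
  third<t (_ ∷ʳ p) with All-resp-⊆ p L<t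
  ... | _ ∷ c<t ∷ _ = c<t
  third<t (refl ∷ p) with All-resp-⊆ p L<t
  ... | c<t ∷ _ = c<t
  no-132 : ∀ {a b c : ℕ} → a ∷ b ∷ c ∷ [] ⊆ t ∷ t′ ∷ L → ¬ Pattern132 a b c
  no-132 (_ ∷ʳ p)   pat           = no132 av′ p pat
  no-132 (refl ∷ p) (_ , t<c , _) = <-asym t<c (third<t p)
  no-2341 : ∀ {a b c d : ℕ} → a ∷ b ∷ c ∷ d ∷ [] ⊆ t ∷ t′ ∷ L → ¬ Pattern2341 a b c d
  no-2341 (_ ∷ʳ p)   pat           = no2341 av′ p pat
  no-2341 (refl ∷ p) (_ , t<c , _) = <-asym t<c (third<t p)
  no-3241 : ∀ {a b c d : ℕ} → a ∷ b ∷ c ∷ d ∷ [] ⊆ t ∷ t′ ∷ L → ¬ Pattern3241 a b c d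
  no-3241 (_ ∷ʳ p)   pat           = no3241 av′ p pat
  no-3241 (refl ∷ p) (_ , t<c , _) = <-asym t<c (third<t p)

⊆-snoc⁻ : ∀ {A : Set} (ys : List A) z xs v → ys ++ z ∷ [] ⊆ xs ++ v ∷ [] → ys ++ z ∷ [] ⊆ xs ⊎ (z ≡ v × ys ⊆ xs)
⊆-snoc⁻ []       z []       v (refl ∷ p) = inj₂ (refl , [])
⊆-snoc⁻ (y ∷ ys) z []       v (refl ∷ p) = ⊥-elim (snoc⊈[] ys p)
  where
  snoc⊈[] : ∀ ys → ¬ (ys ++ z ∷ [] ⊆ [])
  snoc⊈[] []      ()
  snoc⊈[] (_ ∷ _) ()
⊆-snoc⁻ ys       z (x ∷ xs) v (_ ∷ʳ p)   = Sum.map (x ∷ʳ_) (Product.map₂ (x ∷ʳ_)) (⊆-snoc⁻ ys z xs v p)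
⊆-snoc⁻ []       z (x ∷ xs) v (refl ∷ p) = inj₁ (refl ∷ minimum xs)
⊆-snoc⁻ (y ∷ ys) z (x ∷ xs) v (refl ∷ p) = Sum.map (refl ∷_) (Product.map₂ (refl ∷_)) (⊆-snoc⁻ ys z xs v p)
⊆-snoc⁻ []       z []       v (_ ∷ʳ ())
⊆-snoc⁻ (_ ∷ _)  z []       v (_ ∷ʳ ())

-- in each pattern the last entry is exceeded by an earlier one
Avoids-appendMax : ∀ {v xs} → All (_< v) xs → Avoids xs → Avoids (xs ++ v ∷ [])
Avoids-appendMax {v} {xs} xs<v av = record { no132 = no-132 ; no2341 = no-2341 ; no3241 = no-3241 }
  where
  no-132 : ∀ {a b c : ℕ} → a ∷ b ∷ c ∷ [] ⊆ xs ++ v ∷ [] → ¬ Pattern132 a b c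
  no-132 {a} {b} {c} p pat with ⊆-snoc⁻ (a ∷ b ∷ []) c xs v p
  ... | inj₁ q = no132 av q pat
  ... | inj₂ (refl , q) with All-resp-⊆ q xs<v
  ...   | _ ∷ b<v ∷ _ = <⇒≱ b<v (proj₂ (proj₂ pat))
  no-2341 : ∀ {a b c d : ℕ} → a ∷ b ∷ c ∷ d ∷ [] ⊆ xs ++ v ∷ [] → ¬ Pattern2341 a b c d
  no-2341 {a} {b} {c} {d} p pat with ⊆-snoc⁻ (a ∷ b ∷ c ∷ []) d xs v p
  ... | inj₁ q = no2341 av q pat
  ... | inj₂ (refl , q) with All-resp-⊆ q xs<v
  ...   | a<v ∷ _ = <⇒≱ a<v (proj₁ (proj₂ (proj₂ pat)))
  no-3241 : ∀ {a b c d : ℕ} → a ∷ b ∷ c ∷ d ∷ [] ⊆ xs ++ v ∷ [] → ¬ Pattern3241 a b c d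
  no-3241 {a} {b} {c} {d} p pat with ⊆-snoc⁻ (a ∷ b ∷ c ∷ []) d xs v p
  ... | inj₁ q = no3241 av q pat
  ... | inj₂ (refl , q) with All-resp-⊆ q xs<v
  ...   | a<v ∷ _ = <⇒≱ a<v (proj₁ (proj₂ (proj₂ pat)))

Avoids-block : ∀ ℓ {t L} → All (_< t) L → Avoids L → Avoids (block ℓ t ++ L)
Avoids-block single = Avoids-∷-max
Avoids-block pair   = Avoids-∷-ascent (n<1+n _)

Avoids-blocks : ∀ w base R → All (_≤ base) R → Avoids R → Avoids (blocks w base ++ R)
Avoids-blocks []      base R R≤base av = av
Avoids-blocks (ℓ ∷ w) base R R≤base av rewrite ++-assoc (block ℓ (suc (entries w + base))) (blocks w base) R =
  Avoids-block ℓ below (Avoids-blocks w base R R≤base av)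
  where
  below : All (_< suc (entries w + base)) (blocks w base ++ R)
  below = All.++⁺ (All.map (s≤s ∘ proj₂) (blocks-bounded w base))
                  (All.map (λ y≤base → s≤s (≤-trans y≤base (m≤n+m base (entries w)))) R≤base)

Avoids-toPerm : ∀ ws → Avoids (toPerm ws)
Avoids-toPerm []       = Avoids-[]
Avoids-toPerm (w ∷ ws) = Avoids-blocks w (suc (size ws)) (toPerm ws ++ suc (size ws) ∷ [])
  (All.++⁺ (All.map (m≤n⇒m≤1+n ∘ proj₂) (toPerm-bounded ws)) (≤-refl ∷ []))
  (Avoids-appendMax (All.map (s≤s ∘ proj₂) (toPerm-bounded ws)) (Avoids-toPerm ws))

record IsPermutation (n : ℕ) (π : List ℕ) : Set where
  constructor permutation
  field
    length≡ : length π ≡ n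
    bounded : All (λ x → 1 ≤ x × x ≤ n) π
    unique  : Unique π

∈words⁻ : ∀ k A {w} → w ∈ words k A → length w ≡ k × All (_∈ A) w
∈words⁻ zero    A (here refl) = refl , []
∈words⁻ (suc k) A m with find (∈-concatMap⁻ (λ a → map (a ∷_) (words k A)) {xs = A} m)
... | a , a∈A , m′ with ∈-map⁻ (a ∷_) m′
...   | w , w∈ , refl = cong suc (proj₁ (∈words⁻ k A w∈)) , a∈A ∷ proj₂ (∈words⁻ k A w∈)

∈words⁺ : ∀ k A {w} → length w ≡ k → All (_∈ A) w → w ∈ words k A
∈words⁺ zero    A {[]}    refl []         = here refl
∈words⁺ (suc k) A {a ∷ w} refl (a∈A ∷ w⊆A) =
  ∈-concatMap⁺ (λ a → map (a ∷_) (words k A)) (lose a∈A (∈-map⁺ (a ∷_) (∈words⁺ k A refl w⊆A)))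

Unique-words : ∀ k A → Unique A → Unique (words k A)
Unique-words zero    A _   = [] ∷ []
Unique-words (suc k) A uA = prefixed A uA
  where
  W : List (List ℕ)
  W = words k A
  prefixed : ∀ B → Unique B → Unique (concatMap (λ a → map (a ∷_) W) B)
  prefixed []      _            = []
  prefixed (b ∷ B) (b∉B ∷ uB) =
    Unique.++⁺ (Unique.map⁺ (proj₂ ∘ ∷-injective) (Unique-words k A uA)) (prefixed B uB) disjoint
    where
    disjoint : ∀ {v} → ¬ (v ∈ map (b ∷_) W × v ∈ concatMap (λ a → map (a ∷_) W) B)
    disjoint (m₁ , m₂) with ∈-map⁻ (b ∷_) m₁ | find (∈-concatMap⁻ (λ a → map (a ∷_) W) {xs = B} m₂)
    ... | _ , _ , refl | a , a∈B , m₃ with ∈-map⁻ (a ∷_) m₃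
    ...   | _ , _ , refl = All.lookup b∉B a∈B refl

elemᵇ-false⇒∉ : ∀ x xs → elemᵇ x xs ≡ false → All (x ≢_) xs
elemᵇ-false⇒∉ x []       _ = []
elemᵇ-false⇒∉ x (y ∷ ys) h with x ≡ᵇ y in eq
... | false = (λ x≡y → case trans (sym (≡⇒≡ᵇ-true x≡y)) eq of λ ()) ∷ elemᵇ-false⇒∉ x ys h

∉⇒elemᵇ-false : ∀ x xs → All (x ≢_) xs → elemᵇ x xs ≡ false
∉⇒elemᵇ-false x []       _              = refl
∉⇒elemᵇ-false x (y ∷ ys) (x≢y ∷ x∉ys) rewrite ≢⇒≡ᵇ-false x≢y = ∉⇒elemᵇ-false x ys x∉ys

distinct⇒Unique : ∀ π → distinct π ≡ true → Unique π
distinct⇒Unique []       _ = []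
distinct⇒Unique (x ∷ xs) h with elemᵇ x xs in eq
... | false = elemᵇ-false⇒∉ x xs eq ∷ distinct⇒Unique xs h

Unique⇒distinct : ∀ π → Unique π → distinct π ≡ true
Unique⇒distinct []       _            = refl
Unique⇒distinct (x ∷ xs) (x∉xs ∷ uxs) rewrite ∉⇒elemᵇ-false x xs x∉xs = Unique⇒distinct xs uxs

∈S⇒IsPermutation : ∀ n {π} → π ∈ S n → IsPermutation n π
∈S⇒IsPermutation n {π} m with ∈-filter⁻ (λ w → distinct w ≟B true) {xs = words n (applyUpTo suc n)} m
... | m′ , d with ∈words⁻ n _ m′
...   | l , π⊆ = permutation l (All.map range⁻ π⊆) (distinct⇒Unique π d)
  where
  range⁻ : ∀ {x n} → x ∈ applyUpTo suc n → 1 ≤ x × x ≤ n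
  range⁻ m with ∈-applyUpTo⁻ suc m
  ... | i , i<n , refl = s≤s z≤n , i<n

IsPermutation⇒∈S : ∀ n {π} → IsPermutation n π → π ∈ S n
IsPermutation⇒∈S n {π} (permutation l bounded u) =
  ∈-filter⁺ (λ w → distinct w ≟B true) (∈words⁺ n _ l (All.map range⁺ bounded)) (Unique⇒distinct π u)
  where
  range⁺ : ∀ {x} → 1 ≤ x × x ≤ n → x ∈ applyUpTo suc n
  range⁺ {suc x} (_ , x<n) = ∈-applyUpTo⁺ suc x<n

∈P132⇒ : ∀ n {π} → π ∈ P132 n → IsPermutation n π × Avoids π
∈P132⇒ n {π} m with ∈-filter⁻ (λ π → inP132 π ≟B true) {xs = S n} m
... | m′ , h = ∈S⇒IsPermutation n m′ , inP132⇒Avoids π h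

⇒∈P132 : ∀ n {π} → IsPermutation n π → Avoids π → π ∈ P132 n
⇒∈P132 n {π} perm av = ∈-filter⁺ (λ π → inP132 π ≟B true) (IsPermutation⇒∈S n perm) (Avoids⇒inP132 π av)

Unique-P132 : ∀ n → Unique (P132 n)
Unique-P132 n =
  Unique.filter⁺ _ (Unique.filter⁺ _ (Unique-words n _ (Unique.applyUpTo⁺₁ suc n λ i<j _ → <⇒≢ i<j ∘ suc-injective)))

-- Every permutation in P(132) is built from words

bounded-∉ : ∀ {k} ys → All (λ x → 1 ≤ x × x ≤ suc k) ys → suc k ∉ ys → All (λ x → 1 ≤ x × x ≤ k) ys
bounded-∉ ys bounded k+1∉ = All.tabulate λ {x} x∈ →
  let (1≤x , x≤k+1) = All.lookup bounded x∈
  in 1≤x , ≤-pred (≤∧≢⇒< x≤k+1 λ x≡k+1 → k+1∉ (subst (_∈ ys) x≡k+1 x∈))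

length-middle : ∀ {A : Set} (ys : List A) {x} zs → length (ys ++ x ∷ zs) ≡ suc (length (ys ++ zs))
length-middle ys zs = trans (length-++ ys) (trans (+-suc (length ys) (length zs)) (cong suc (sym (length-++ ys))))

Unique-bounded⇒length≤ : ∀ k xs → Unique xs → All (λ x → 1 ≤ x × x ≤ k) xs → length xs ≤ k
Unique-bounded⇒length≤ zero    []       _ _ = z≤n
Unique-bounded⇒length≤ zero    (x ∷ xs) _ ((1≤x , x≤0) ∷ _) with () ← ≤-trans 1≤x x≤0
Unique-bounded⇒length≤ (suc k) xs u bounded with suc k ∈? xs
... | no  k+1∉ = m≤n⇒m≤1+n (Unique-bounded⇒length≤ k xs u (bounded-∉ xs bounded k+1∉))
... | yes k+1∈ with ∈-∃++ k+1∈
...   | ys , zs , refl with Unique-remove ys u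
...     | u′ , k+1∉ = subst (_≤ suc k) (sym (length-middle ys zs))
          (s≤s (Unique-bounded⇒length≤ k (ys ++ zs) u′
                 (bounded-∉ (ys ++ zs) (All.++⁺ (All.++⁻ˡ ys bounded) (All.tail (All.++⁻ʳ ys bounded))) k+1∉)))

max∈ : ∀ {n π} → IsPermutation (suc n) π → suc n ∈ π
max∈ {n} {π} (permutation l bounded u) with suc n ∈? π
... | yes n+1∈ = n+1∈
... | no  n+1∉ with () ← <-irrefl l (s≤s (Unique-bounded⇒length≤ n π u (bounded-∉ π bounded n+1∉)))

IsPermutation-removeMax : ∀ {n} π′ π″ → IsPermutation (suc n) (π′ ++ suc n ∷ π″) → IsPermutation n (π′ ++ π″)
IsPermutation-removeMax {n} π′ π″ (permutation l bounded u) with Unique-remove π′ u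
... | u′ , n+1∉ = permutation
  (suc-injective (trans (sym (length-middle π′ π″)) l))
  (bounded-∉ (π′ ++ π″) (All.++⁺ (All.++⁻ˡ π′ bounded) (All.tail (All.++⁻ʳ π′ bounded))) n+1∉)
  u′

Decomposes : ℕ → List ℕ → Set
Decomposes N π = ∃ λ ws → size ws ≡ N × toPerm ws ≡ π

Decomposes-appendMax : ∀ {N π} → Decomposes N π → Decomposes (suc N) (π ++ suc N ∷ [])
Decomposes-appendMax (ws , refl , refl) = [] ∷ ws , refl , refl

Decomposes-consMax : ∀ {N y ρ} → Decomposes N (y ∷ ρ) → Decomposes (suc N) (suc N ∷ y ∷ ρ)
Decomposes-consMax ([]           , _    , ())
Decomposes-consMax ((w ∷ ws) , refl , w∷ws↦) =
  (single ∷ w) ∷ ws , refl , cong₂ _∷_ (cong suc (+-suc (entries w) (size ws))) w∷ws↦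

Decomposes-consAscent : ∀ {N y ρ} → Decomposes N (y ∷ ρ) → Decomposes (suc (suc N)) (suc N ∷ suc (suc N) ∷ y ∷ ρ)
Decomposes-consAscent ([]           , _    , ())
Decomposes-consAscent ((w ∷ ws) , refl , w∷ws↦) =
  (pair ∷ w) ∷ ws , refl , cong₂ (λ t π → suc t ∷ suc (suc t) ∷ π) (+-suc (entries w) (size ws)) w∷ws↦

-- otherwise x, N + 1, z would form a 132
after-max-below : ∀ {N x ρ} → IsPermutation N (x ∷ ρ) → x < suc N → Avoids (x ∷ suc N ∷ ρ) → All (_< x) ρ
after-max-below {N} {x} {ρ} (permutation _ bounded (x∉ρ ∷ _)) x<N+1 av = All.tabulate λ {z} z∈ρ →
  ≤∧≢⇒< (≮⇒≥ λ x<z → no132 av (refl ∷ refl ∷ from∈ z∈ρ) (x<N+1 , x<z , m≤n⇒m≤1+n (proj₂ (All.lookup (All.tail bounded) z∈ρ))))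
        (λ z≡x → All.lookup x∉ρ z∈ρ (sym z≡x))

-- two entries in front of the maximum and one after it always form a 2341 or a 3241
two-before-max : ∀ {N x₁ x₂ r y ρ} → All (_< N) (x₁ ∷ x₂ ∷ r) → y < N → ¬ Avoids (x₁ ∷ x₂ ∷ r ++ N ∷ y ∷ ρ)
two-before-max {N} {x₁} {x₂} {r} {y} {ρ} (x₁<N ∷ x₂<N ∷ _) y<N av = occurs (x₁ <? x₂)
  where
  tail : N ∷ y ∷ [] ⊆ r ++ N ∷ y ∷ ρ
  tail = ++⁺ˡ r (refl ∷ refl ∷ minimum ρ)
  y≤x₁ : y ≤ x₁
  y≤x₁ = ≮⇒≥ λ x₁<y → no132 av (refl ∷ x₂ ∷ʳ tail) (x₁<N , x₁<y , <⇒≤ y<N)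
  y≤x₂ : y ≤ x₂
  y≤x₂ = ≮⇒≥ λ x₂<y → no132 av (x₁ ∷ʳ refl ∷ tail) (x₂<N , x₂<y , <⇒≤ y<N)
  occurs : Dec (x₁ < x₂) → ⊥
  occurs (yes x₁<x₂) = no2341 av (refl ∷ refl ∷ tail) (x₁<x₂ , x₁<N , y≤x₁ , x₂<N , y≤x₂ , <⇒≤ y<N)
  occurs (no  x₁≮x₂) = no3241 av (refl ∷ refl ∷ tail) (≮⇒≥ x₁≮x₂ , x₁<N , y≤x₁ , x₂<N , y≤x₂ , <⇒≤ y<N)

max-before-rest : ∀ {L x ρ} → IsPermutation (suc L) (x ∷ ρ) → All (_< x) ρ → x ≡ suc L
max-before-rest {L} perm below with max∈ perm
... | here  L+1≡x = sym L+1≡x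
... | there L+1∈ρ with () ← <⇒≱ (All.lookup below L+1∈ρ) (proj₂ (All.head (IsPermutation.bounded perm)))

AllDecompose : ℕ → Set
AllDecompose N = ∀ {π} → IsPermutation N π → Avoids π → Decomposes N π

Decomposes-ascent : ∀ {N x y ρ} → IsPermutation N (x ∷ y ∷ ρ) → All (_< x) (y ∷ ρ) → Avoids (y ∷ ρ) →
  AllDecompose (pred N) → Decomposes (suc N) (x ∷ suc N ∷ y ∷ ρ)
Decomposes-ascent {zero}  (permutation () _ _)
Decomposes-ascent {suc L} {y = y} {ρ} perm below av smaller with max-before-rest perm below
... | refl = Decomposes-consAscent (smaller (IsPermutation-removeMax [] (y ∷ ρ) perm) av)

decompose : ∀ N → AllDecompose N
decompose = <-rec AllDecompose step
  where
  step : ∀ N → (∀ {M} → M < N → AllDecompose M) → AllDecompose N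
  step zero    _       {[]}    _                    _  = [] , refl , refl
  step zero    _       {_ ∷ _} (permutation () _ _) _
  step (suc N) smaller perm av with ∈-∃++ (max∈ perm)
  ... | π′ , π″ , refl = split π′ π″ perm av
    where
    split : ∀ π′ π″ → IsPermutation (suc N) (π′ ++ suc N ∷ π″) → Avoids (π′ ++ suc N ∷ π″) →
            Decomposes (suc N) (π′ ++ suc N ∷ π″)
    split π′ [] perm av =
      Decomposes-appendMax (smaller ≤-refl (subst (IsPermutation N) (++-identityʳ π′) (IsPermutation-removeMax π′ [] perm))
                                           (Avoids-⊆ (++⁺ʳ _ ⊆-refl) av))
    split [] (y ∷ ρ) perm av =
      Decomposes-consMax (smaller ≤-refl (IsPermutation-removeMax [] (y ∷ ρ) perm) (Avoids-⊆ (suc N ∷ʳ ⊆-refl) av))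
    split (x ∷ []) (y ∷ ρ) perm av = let perm′ = IsPermutation-removeMax (x ∷ []) (y ∷ ρ) perm in
      Decomposes-ascent perm′ (after-max-below perm′ (s≤s (proj₂ (All.head (IsPermutation.bounded perm′)))) av)
                        (Avoids-⊆ (x ∷ʳ suc N ∷ʳ ⊆-refl) av) (smaller (s≤s pred[n]≤n))
    split (x₁ ∷ x₂ ∷ r) (y ∷ ρ) perm av
      with below ← All.map (s≤s ∘ proj₂) (IsPermutation.bounded (IsPermutation-removeMax (x₁ ∷ x₂ ∷ r) (y ∷ ρ) perm))
      = ⊥-elim (two-before-max (All.++⁻ˡ (x₁ ∷ x₂ ∷ r) below) (All.head (All.++⁻ʳ (x₁ ∷ x₂ ∷ r) below)) av)

++-injective : ∀ {A : Set} (xs xs′ : List A) {ys ys′} → length xs ≡ length xs′ → xs ++ ys ≡ xs′ ++ ys′ → xs ≡ xs′ × ys ≡ ys′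
++-injective []       []        _ eq = refl , eq
++-injective (x ∷ xs) (x′ ∷ xs′) l eq with refl , eq′ ← ∷-injective eq =
  Product.map₁ (cong (x ∷_)) (++-injective xs xs′ (suc-injective l) eq′)

blockSize-injective : ∀ ℓ ℓ′ → blockSize ℓ ≡ blockSize ℓ′ → ℓ ≡ ℓ′
blockSize-injective single single _ = refl
blockSize-injective pair   pair   _ = refl

blocks-∷-entries : ∀ ℓ ℓ′ w w′ b → blocks (ℓ ∷ w) b ≡ blocks (ℓ′ ∷ w′) b → entries w ≡ entries w′
blocks-∷-entries single single _ _ _ eq = +-cancelʳ-≡ _ _ _ (suc-injective (proj₁ (∷-injective eq)))
blocks-∷-entries single pair   _ _ _ eq = +-cancelʳ-≡ _ _ _ (suc-injective (proj₁ (∷-injective eq)))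
blocks-∷-entries pair   single _ _ _ eq = +-cancelʳ-≡ _ _ _ (suc-injective (proj₁ (∷-injective eq)))
blocks-∷-entries pair   pair   _ _ _ eq = +-cancelʳ-≡ _ _ _ (suc-injective (proj₁ (∷-injective eq)))

blocks-injective : ∀ w w′ b → blocks w b ≡ blocks w′ b → w ≡ w′
blocks-injective []      []             b _ = refl
blocks-injective []      (single ∷ _)   b ()
blocks-injective []      (pair ∷ _)     b ()
blocks-injective (single ∷ _) []        b ()
blocks-injective (pair ∷ _)   []        b ()
blocks-injective (ℓ ∷ w) (ℓ′ ∷ w′) b eq with entries≡ ← blocks-∷-entries ℓ ℓ′ w w′ b eq
  with refl ← blockSize-injective ℓ ℓ′ (+-cancelʳ-≡ (entries w′) _ _ (trans (cong (_+_ (blockSize ℓ)) (sym entries≡))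
                (trans (sym (length-blocks (ℓ ∷ w) b)) (trans (cong length eq) (length-blocks (ℓ′ ∷ w′) b)))))
  = cong (ℓ ∷_) (blocks-injective w w′ b (++-cancelˡ (block ℓ (suc (entries w′ + b))) _ _
                   (trans (cong (λ n → block ℓ (suc (n + b)) ++ blocks w b) (sym entries≡)) eq)))

toPerm-injective : ∀ ws ws′ → toPerm ws ≡ toPerm ws′ → ws ≡ ws′
toPerm-injective []       []         _  = refl
toPerm-injective []       (w′ ∷ ws′) eq with () ← trans (cong length eq) (length-toPerm (w′ ∷ ws′))
toPerm-injective (w ∷ ws) []         eq with () ← trans (cong length (sym eq)) (length-toPerm (w ∷ ws))
toPerm-injective (w ∷ ws) (w′ ∷ ws′) eq =
  cong₂ _∷_ (blocks-injective w w′ b (trans (proj₁ halves) (cong (blocks w′ ∘ suc) (sym size≡))))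
            (toPerm-injective ws ws′ (proj₂ halves))
  where
  open ≡-Reasoning
  b b′ : ℕ
  b  = suc (size ws)
  b′ = suc (size ws′)
  split : blocks w b ++ toPerm ws ≡ blocks w′ b′ ++ toPerm ws′ × b ≡ b′
  split = ∷ʳ-injective (blocks w b ++ toPerm ws) (blocks w′ b′ ++ toPerm ws′)
            (trans (++-assoc (blocks w b) (toPerm ws) _) (trans eq (sym (++-assoc (blocks w′ b′) (toPerm ws′) _))))
  size≡ : size ws ≡ size ws′
  size≡ = suc-injective (proj₂ split)
  entries≡ : entries w ≡ entries w′
  entries≡ = +-cancelʳ-≡ (size ws′) _ _ (begin
    entries w + size ws′                           ≡⟨ cong₂ _+_ (length-blocks w b) (trans (length-toPerm ws) size≡) ⟨
    length (blocks w b) + length (toPerm ws)       ≡⟨ length-++ (blocks w b) ⟨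
    length (blocks w b ++ toPerm ws)               ≡⟨ cong length (proj₁ split) ⟩
    length (blocks w′ b′ ++ toPerm ws′)            ≡⟨ length-++ (blocks w′ b′) ⟩
    length (blocks w′ b′) + length (toPerm ws′)    ≡⟨ cong₂ _+_ (length-blocks w′ b′) (length-toPerm ws′) ⟩
    entries w′ + size ws′                          ∎)
  halves : blocks w b ≡ blocks w′ b′ × toPerm ws ≡ toPerm ws′
  halves = ++-injective (blocks w b) (blocks w′ b′) (trans (length-blocks w b) (trans entries≡ (sym (length-blocks w′ b′)))) (proj₁ split)

Unique-blocks : ∀ w b → Unique (blocks w b)
Unique-blocks []           b = []
Unique-blocks (single ∷ w) b = All.map (λ (_ , x≤) → >⇒≢ (s≤s x≤)) (blocks-bounded w b) ∷ Unique-blocks w b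
Unique-blocks (pair ∷ w)   b = (<⇒≢ (n<1+n _) ∷ All.map (λ (_ , x≤) → >⇒≢ (s≤s x≤)) (blocks-bounded w b))
                             ∷ All.map (λ (_ , x≤) → >⇒≢ (s≤s (m≤n⇒m≤1+n x≤))) (blocks-bounded w b) ∷ Unique-blocks w b

Unique-toPerm : ∀ ws → Unique (toPerm ws)
Unique-toPerm []       = []
Unique-toPerm (w ∷ ws) = Unique.++⁺ (Unique-blocks w base)
  (Unique.++⁺ (Unique-toPerm ws) ([] ∷ [])
               λ { (x∈ , here x≡base) → <⇒≢ (s≤s (proj₂ (All.lookup (toPerm-bounded ws) x∈))) x≡base })
  λ (x∈blocks , x∈rest) → <-irrefl refl (All.lookup (All.lookup (blocks-above ws w) x∈blocks) x∈rest)
  where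
  base : ℕ
  base = suc (size ws)
  blocks-above : ∀ ws w → blocks w (suc (size ws)) ≻ toPerm ws ++ suc (size ws) ∷ []
  blocks-above ws w =
    All.map (λ (base<x , _) → All.++⁺ (All.map (λ (_ , y≤) → <-trans (s≤s y≤) base<x) (toPerm-bounded ws)) (base<x ∷ []))
            (blocks-bounded w (suc (size ws)))

∈wordsUpTo⁻ : ∀ K {w} → w ∈ wordsUpTo K → length w ≤ K
∈wordsUpTo⁻ zero    (here refl) = z≤n
∈wordsUpTo⁻ (suc K) (here refl) = z≤n
∈wordsUpTo⁻ (suc K) (there m) with ∈-++⁻ (map (single ∷_) (wordsUpTo K)) m
... | inj₁ m₁ with ∈-map⁻ (single ∷_) m₁
...   | w , w∈ , refl = s≤s (∈wordsUpTo⁻ K w∈)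
∈wordsUpTo⁻ (suc K) (there m) | inj₂ m₂ with ∈-map⁻ (pair ∷_) m₂
...   | w , w∈ , refl = s≤s (∈wordsUpTo⁻ K w∈)

∈wordsUpTo⁺ : ∀ K {w} → length w ≤ K → w ∈ wordsUpTo K
∈wordsUpTo⁺ zero    {[]}         _         = here refl
∈wordsUpTo⁺ (suc K) {[]}         _         = here refl
∈wordsUpTo⁺ (suc K) {single ∷ w} (s≤s |w|≤K) = there (∈-++⁺ˡ (∈-map⁺ (single ∷_) (∈wordsUpTo⁺ K |w|≤K)))
∈wordsUpTo⁺ (suc K) {pair ∷ w}   (s≤s |w|≤K) = there (∈-++⁺ʳ (map (single ∷_) (wordsUpTo K)) (∈-map⁺ (pair ∷_) (∈wordsUpTo⁺ K |w|≤K)))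

Unique-wordsUpTo : ∀ K → Unique (wordsUpTo K)
Unique-wordsUpTo zero    = [] ∷ []
Unique-wordsUpTo (suc K) = All.tabulate nonempty ∷ Unique.++⁺ (prefixed single) (prefixed pair) disjoint
  where
  prefixed : ∀ ℓ → Unique (map (ℓ ∷_) (wordsUpTo K))
  prefixed ℓ = Unique.map⁺ (proj₂ ∘ ∷-injective) (Unique-wordsUpTo K)
  nonempty : ∀ {v} → v ∈ map (single ∷_) (wordsUpTo K) ++ map (pair ∷_) (wordsUpTo K) → [] ≢ v
  nonempty m with ∈-++⁻ (map (single ∷_) (wordsUpTo K)) m
  ... | inj₁ m₁ with ∈-map⁻ (single ∷_) m₁
  ...   | _ , _ , refl = λ ()
  nonempty m | inj₂ m₂ with ∈-map⁻ (pair ∷_) m₂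
  ...   | _ , _ , refl = λ ()
  disjoint : ∀ {v} → ¬ (v ∈ map (single ∷_) (wordsUpTo K) × v ∈ map (pair ∷_) (wordsUpTo K))
  disjoint (m₁ , m₂) with ∈-map⁻ (single ∷_) m₁ | ∈-map⁻ (pair ∷_) m₂
  ... | _ , _ , refl | _ , _ , ()

∈tuples⁻ : ∀ K n {ws} → ws ∈ tuples K n → All (λ w → length w ≤ K) ws
∈tuples⁻ K zero    (here refl) = []
∈tuples⁻ K (suc n) m with ∈-map⁻ snoc m
... | (ws , w) , ws,w∈ , refl with ∈-cartesianProduct⁻ (tuples K n) (wordsUpTo K) ws,w∈
...   | ws∈ , w∈ = All.++⁺ (∈tuples⁻ K n ws∈) (∈wordsUpTo⁻ K w∈ ∷ [])

∈tuples⁺ : ∀ K n {ws} → length ws ≡ n → All (λ w → length w ≤ K) ws → ws ∈ tuples K n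
∈tuples⁺ K zero    {[]} refl [] = here refl
∈tuples⁺ K (suc n) {ws} l short with initLast ws
... | []       with () ← l
... | vs ∷ʳ′ v = ∈-map⁺ snoc (∈-cartesianProduct⁺
  (∈tuples⁺ K n (suc-injective (trans (sym (length-snoc vs v)) l)) (All.++⁻ˡ vs short))
  (∈wordsUpTo⁺ K (All.head (All.++⁻ʳ vs short))))

Unique-tuples : ∀ K n → Unique (tuples K n)
Unique-tuples K zero    = [] ∷ []
Unique-tuples K (suc n) =
  Unique.map⁺ (λ {(ws , w)} {(ws′ , w′)} eq → let (ws≡ , w≡) = ∷ʳ-injective ws ws′ eq in cong₂ _,_ ws≡ w≡)
              (Unique.cartesianProduct⁺ (Unique-tuples K n) (Unique-wordsUpTo K))

-- tuples of fewer than n words, each of length at most K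
shortTuples : ℕ → ℕ → List (List Word)
shortTuples K zero    = []
shortTuples K (suc n) = shortTuples K n ++ tuples K n

∈shortTuples⁺ : ∀ K n {ws} → length ws < n → All (λ w → length w ≤ K) ws → ws ∈ shortTuples K n
∈shortTuples⁺ K (suc n) |ws|<1+n short with m≤n⇒m<n∨m≡n (≤-pred |ws|<1+n)
... | inj₁ |ws|<n = ∈-++⁺ˡ (∈shortTuples⁺ K n |ws|<n short)
... | inj₂ |ws|≡n = ∈-++⁺ʳ (shortTuples K n) (∈tuples⁺ K n |ws|≡n short)

length-∈shortTuples : ∀ K n {ws} → ws ∈ shortTuples K n → length ws < n
length-∈shortTuples K (suc n) m with ∈-++⁻ (shortTuples K n) m
... | inj₁ m₁ = m<n⇒m<1+n (length-∈shortTuples K n m₁)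
... | inj₂ m₂ = s≤s (≤-reflexive (length-∈tuples K n m₂))

Unique-shortTuples : ∀ K n → Unique (shortTuples K n)
Unique-shortTuples K zero    = []
Unique-shortTuples K (suc n) = Unique.++⁺ (Unique-shortTuples K n) (Unique-tuples K n)
  λ (m₁ , m₂) → <-irrefl (length-∈tuples K n m₂) (length-∈shortTuples K n m₁)

-- Both sides count word sequences

weighs : Mono → List Word → Bool
weighs e ws = sameMono (weight ws) e

exponent₀-weight : ∀ ws → exponent 0 (weight ws) ≡ size ws
exponent₀-weight ws = begin
  exponent 0 (weight ws)          ≡⟨ at (monoOf-toPerm ws) 0 ⟨
  exponent 0 (monoOf (toPerm ws)) ≡⟨ exponent-monoOf (toPerm ws) 0 ⟩
  inc 1 (toPerm ws)               ≡⟨ inc-1 (toPerm ws) ⟩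
  length (toPerm ws)              ≡⟨ length-toPerm ws ⟩
  size ws                         ∎
  where open ≡-Reasoning

weighs⇒size : ∀ e ws → weighs e ws ≡ true → size ws ≡ exponent 0 e
weighs⇒size e ws h = trans (sym (exponent₀-weight ws)) (at (sameMono⇒≋ (weight ws) e h) 0)

length≤entries : ∀ w → length w ≤ entries w
length≤entries []           = z≤n
length≤entries (single ∷ w) = s≤s (length≤entries w)
length≤entries (pair ∷ w)   = s≤s (m≤n⇒m≤1+n (length≤entries w))

length≤size : ∀ ws → length ws ≤ size ws
length≤size []       = z≤n
length≤size (w ∷ ws) = s≤s (≤-trans (length≤size ws) (m≤n+m (size ws) (entries w)))

words-length≤size : ∀ ws → All (λ w → length w ≤ size ws) ws
words-length≤size []       = []
words-length≤size (w ∷ ws) =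
  ≤-trans (length≤entries w) (≤-trans (m≤m+n (entries w) (size ws)) (n≤1+n _))
  ∷ All.map (λ ≤size → ≤-trans ≤size (≤-trans (m≤n+m (size ws) (entries w)) (n≤1+n _))) (words-length≤size ws)

sizedSequences : ℕ → List (List Word)
sizedSequences K = filter (λ ws → (size ws ≡ᵇ K) ≟B true) (shortTuples K (suc K))

Unique-toPerm-sized : ∀ K → Unique (map toPerm (sizedSequences K))
Unique-toPerm-sized K = Unique.map⁺ (toPerm-injective _ _) (Unique.filter⁺ _ (Unique-shortTuples K (suc K)))

∈P132⇒∈toPerm-sized : ∀ K {π} → π ∈ P132 K → π ∈ map toPerm (sizedSequences K)
∈P132⇒∈toPerm-sized K π∈ with perm , av ← ∈P132⇒ K π∈ with ws , size≡K , refl ← decompose K perm av =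
  ∈-map⁺ toPerm (∈-filter⁺ _ (∈shortTuples⁺ K (suc K) (s≤s (subst (length ws ≤_) size≡K (length≤size ws)))
                                                     (All.map (subst (_ ≤_) size≡K) (words-length≤size ws)))
                             (≡⇒≡ᵇ-true size≡K))

∈toPerm-sized⇒∈P132 : ∀ K {π} → π ∈ map toPerm (sizedSequences K) → π ∈ P132 K
∈toPerm-sized⇒∈P132 K π∈ with ws , ws∈ , refl ← ∈-map⁻ toPerm π∈
  with _ , size≡ᵇK ← ∈-filter⁻ (λ ws → (size ws ≡ᵇ K) ≟B true) {xs = shortTuples K (suc K)} ws∈
  = subst (λ N → toPerm ws ∈ P132 N) (≡ᵇ-true⇒≡ {size ws} size≡ᵇK)
      (⇒∈P132 (size ws) (permutation (length-toPerm ws) (toPerm-bounded ws) (Unique-toPerm ws)) (Avoids-toPerm ws))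

-- a sequence of weight e has size K = exponent 0 e, hence at most K words, each of length at most K
sequencesSeries : FPS
sequencesSeries e = + countᵇ (weighs e) (shortTuples (exponent 0 e) (suc (exponent 0 e)))

module _ (e : Mono) where

  private
    K : ℕ
    K = exponent 0 e

  lhsTerm-off-degree : ∀ N → N ≢ K → lhsTerm N e ≡ 0ℤ
  lhsTerm-off-degree N N≢K = cong +_ (trans (length-filter _ (P132 N)) (countᵇ-none _ (P132 N) off))
    where
    off : ∀ {π} → π ∈ P132 N → sameMono (monoOf π) e ≡ false
    off {π} π∈ with sameMono (monoOf π) e in eq
    ... | false = refl
    ... | true  = ⊥-elim (N≢K (begin
      N                      ≡⟨ IsPermutation.length≡ (proj₁ (∈P132⇒ N π∈)) ⟨
      length π               ≡⟨ inc-1 π ⟨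
      inc 1 π                ≡⟨ exponent-monoOf π 0 ⟨
      exponent 0 (monoOf π)  ≡⟨ at (sameMono⇒≋ (monoOf π) e eq) 0 ⟩
      K                      ∎))
      where open ≡-Reasoning

  lhsTerm-at-degree : lhsTerm K e ≡ sequencesSeries e
  lhsTerm-at-degree = cong +_ (begin
    length (filter _ (P132 K))                                  ≡⟨ length-filter _ (P132 K) ⟩
    countᵇ (λ π → sameMono (monoOf π) e) (P132 K)
      ≡⟨ countᵇ-sameMembers _ (P132 K) (map toPerm (sizedSequences K)) (Unique-P132 K) (Unique-toPerm-sized K)
                            (∈P132⇒∈toPerm-sized K) (∈toPerm-sized⇒∈P132 K) ⟩
    countᵇ (λ π → sameMono (monoOf π) e) (map toPerm (sizedSequences K))
      ≡⟨ countᵇ-map _ toPerm (sizedSequences K) ⟩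
    countᵇ (λ ws → sameMono (monoOf (toPerm ws)) e) (sizedSequences K)
      ≡⟨ countᵇ-cong (sizedSequences K) (λ {ws} _ → sameMono-cong (monoOf-toPerm ws) (≋-refl {e})) ⟩
    countᵇ (weighs e) (sizedSequences K)
      ≡⟨ countᵇ-filter (λ ws → size ws ≡ᵇ K) (weighs e) (shortTuples K (suc K)) ⟩
    countᵇ (λ ws → (size ws ≡ᵇ K) ∧ weighs e ws) (shortTuples K (suc K))
      ≡⟨ countᵇ-cong (shortTuples K (suc K)) (λ {ws} _ → sized-if-weighs ws) ⟩
    countᵇ (weighs e) (shortTuples K (suc K)) ∎)
    where
    open ≡-Reasoning
    sized-if-weighs : ∀ ws → ((size ws ≡ᵇ K) ∧ weighs e ws) ≡ weighs e ws
    sized-if-weighs ws with weighs e ws in eq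
    ... | false = ∧-zeroʳ _
    ... | true  = cong (_∧ true) (≡⇒≡ᵇ-true (weighs⇒size e ws eq))

norm-idempotent : ∀ e → norm (norm e) ≡ norm e
norm-idempotent e = norm-cong (norm-≋ e)

rhsTerm-norm : ∀ G n e → rhsTerm G n (norm e) ≡ rhsTerm G n e
rhsTerm-norm G zero    e = cong boolℤ (sameMono-cong (≋-refl {[]}) (norm-≋ e))
rhsTerm-norm G (suc n) e =
  cong (λ E → sumℤ (map (λ p → mono (numExp (suc n)) (norm (proj₁ p)) *ℤ prodFrom1 G (suc n) (norm (proj₂ p))) (splits E)))
       (norm-idempotent e)

module _ (G : ℕ → FPS) (inverse : AreInverses G) (e : Mono) where

  private
    K : ℕ
    K = exponent 0 e

  rhsTerm-counts : ∀ n → rhsTerm G n e ≡ + countᵇ (weighs e) (tuples K n)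
  rhsTerm-counts n = trans (sym (rhsTerm-norm G n e)) (coefficient (rhsTerm-enumerates-tuples G inverse K n) e ≤-refl)

  rhsTerm-beyond-degree : ∀ n → K < n → rhsTerm G n e ≡ 0ℤ
  rhsTerm-beyond-degree n K<n = trans (rhsTerm-counts n) (cong +_ (countᵇ-none _ (tuples K n) beyond))
    where
    beyond : ∀ {ws} → ws ∈ tuples K n → weighs e ws ≡ false
    beyond {ws} ws∈ with weighs e ws in eq
    ... | false = refl
    ... | true with () ← <⇒≱ K<n (subst (_≤ K) (length-∈tuples K n ws∈)
                                   (subst (length ws ≤_) (weighs⇒size e ws eq) (length≤size ws)))

  partial-rhsTerm : ∀ M → partial (rhsTerm G) M e ≡ + countᵇ (weighs e) (shortTuples K M)
  partial-rhsTerm zero    = refl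
  partial-rhsTerm (suc M) = trans (cong₂ _+ℤ_ (partial-rhsTerm M) (rhsTerm-counts M))
                                  (cong +_ (sym (countᵇ-++ (weighs e) (shortTuples K M) (tuples K M))))

partial-vanishing : ∀ T e M → (∀ n → n < M → T n e ≡ 0ℤ) → partial T M e ≡ 0ℤ
partial-vanishing T e zero    _         = refl
partial-vanishing T e (suc M) vanishing =
  cong₂ _+ℤ_ (partial-vanishing T e M λ n n<M → vanishing n (m<n⇒m<1+n n<M)) (vanishing M ≤-refl)

SumsTo-eventually : ∀ T S → (∀ e → ∃ λ N → (∀ n → N ≤ n → T n e ≡ 0ℤ) × partial T N e ≡ S e) → SumsTo T S
SumsTo-eventually T S eventually e with N , vanishing , partial≡ ← eventually e =
  N , λ M N≤M → trans (stable M N≤M) partial≡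
  where
  stable : ∀ M → N ≤ M → partial T M e ≡ partial T N e
  stable M N≤M with m≤n⇒m<n∨m≡n N≤M
  ... | inj₂ refl = refl
  ... | inj₁ N<M with suc M′ ← M = trans (cong₂ _+ℤ_ (stable M′ (≤-pred N<M)) (vanishing M′ (≤-pred N<M))) (ℤ.+-identityʳ _)

mainTheorem11 : (G : ℕ → FPS) → AreInverses G →
    ∃ λ (F : FPS) → SumsTo lhsTerm F × SumsTo (rhsTerm G) F
mainTheorem11 G inverse =
  sequencesSeries , SumsTo-eventually lhsTerm sequencesSeries lhs , SumsTo-eventually (rhsTerm G) sequencesSeries rhs
  where
  lhs : ∀ e → ∃ λ N → (∀ n → N ≤ n → lhsTerm n e ≡ 0ℤ) × partial lhsTerm N e ≡ sequencesSeries e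
  lhs e = suc (exponent 0 e)
        , (λ n K<n → lhsTerm-off-degree e n (>⇒≢ K<n))
        , trans (cong₂ _+ℤ_ (partial-vanishing lhsTerm e (exponent 0 e) λ n n<K → lhsTerm-off-degree e n (<⇒≢ n<K))
                            (lhsTerm-at-degree e))
                (ℤ.+-identityˡ _)
  rhs : ∀ e → ∃ λ N → (∀ n → N ≤ n → rhsTerm G n e ≡ 0ℤ) × partial (rhsTerm G) N e ≡ sequencesSeries e
  rhs e = suc (exponent 0 e) , rhsTerm-beyond-degree G inverse e , partial-rhsTerm G inverse e (suc (exponent 0 e))
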